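{- Let $k \leq n$ be positive integers and let $\lambda = (\lambda_1 \geq \cdots \geq \lambda_s\ge 0)$ be a partition of $k$ with $s$ parts. The map $\mathtt{code}: \mathcal{OP}_{n,\lambda} \to \mathcal{C}_{n,\lambda}$, $\sigma\mapsto\mathtt{code}(\sigma)$, is a well-defined bijection.
   Context: A partition of $k$ with $s$ parts is a weakly decreasing sequence of $s$ nonnegative integers (trailing zeros allowed) summing to $k$; $\lambda'$ is its conjugate ($\lambda'_j=\#\{i:\lambda_i\ge j\}$). $\mathcal{OP}_{n,\lambda}$ is the set of sequences $\sigma=(B_1\mid\cdots\mid B_s)$ of (possibly empty) subsets of $[n]$ with $[n]=B_1\sqcup\cdots\sqcup B_s$ and $|B_i|\ge\lambda_i$. Container diagram: column $i$ has $\lambda_i$ top-justified boxes (rows numbered from the top); the box in row $j$ ($1\le j\le \lambda_i$) of column $i$ holds the $(\lambda_i-j+1)$-th smallest element of $B_i$; the other $|B_i|-\lambda_i$ (largest) elements of $B_i$ are floating in block $i$. "To the right/left" refers to block indices. For $1\le i<j\le n$, $(i,j)$ is a coinversion of $\sigma$ if: (a) $i$ is floating, $j$ is in a block to the right of $i$, and $j$ is in the top row of the container; or (b) $i$ is not floating, $j$ is in a block to the right of $i$, and $i,j$ are in the same container row; or (c) $i$ is not floating, $j$ is in a block to the left of $i$, and $j$ is in the container row directly below that of $i$. Let $c_i$ be the number of $j>i$ with $(i,j)$ a coinversion, plus $p-1$ if $i$ is floating in block $p$; $\mathtt{code}(\sigma)=(c_1,\dots,c_n)$. $\mathcal{C}_{n,\lambda}$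 is the set of length-$n$ sequences of nonnegative integers that are componentwise $\le$ some shuffle (order-preserving interleaving) of the sequences $(\lambda'_j-1,\dots,1,0)$ for $j=1,\dots,k$ (empty when $\lambda'_j=0$) and the constant sequence $(s-1,\dots,s-1)$ of length $n-k$. -}

module Defs where

import Agda.Primitive

open import Data.Nat as ℕ using (ℕ; zero; suc; _+_; _∸_; _≤_; _<_)
import Data.Nat.Properties as ℕP
open import Data.Fin as Fin using (Fin; toℕ)
import Data.Fin.Properties as FinP
open import Data.Nat.ListAction using (sum)
open import Data.List using (List; []; _∷_; _++_; map; length; filter; allFin; downFrom; upTo; replicate)
open import Data.List.Relation.Binary.Pointwise using (Pointwise)
open import Data.List.Relation.Ternary.Interleaving.Propositional using (Interleaving)
open import Data.Product using (Σ; _×_; ∃)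
open import Data.Sum using (_⊎_)
open import Data.Bool using (if_then_else_)
open import Relation.Nullary using (¬_; Dec; ¬?; _×-dec_; _⊎-dec_; ⌊_⌋)
open import Relation.Unary using (Pred; Decidable)
open import Relation.Binary.PropositionalEquality using (_≡_)

count : ∀ {n} {P : Pred (Fin n) Agda.Primitive.lzero} → Decidable P → ℕ
count {n} P? = length (filter P? (allFin n))

IsPartition : (k s : ℕ) → (Fin s → ℕ) → Set
IsPartition k s lam =
  (∀ (i j : Fin s) → i Fin.≤ j → lam j ≤ lam i) × sum (map lam (allFin s)) ≡ k

conj : ∀ {s} → (Fin s → ℕ) → ℕ → ℕ
conj lam j = count (λ i → j ℕ.≤? lam i)

-- An element σ = (B_1 | ... | B_s) of OP_{n,λ}
-- is encoded by its block-assignment map f : Fin n → Fin s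
-- (B_{i+1} = f⁻¹(i); [n] = {1..n} is Fin n with its natural order,
-- blocks are indexed 0..s-1).

BlockSize : ∀ {n s} → (Fin n → Fin s) → Fin s → ℕ
BlockSize f i = count (λ x → f x Fin.≟ i)

InOP : (n s : ℕ) → (Fin s → ℕ) → (Fin n → Fin s) → Set
InOP n s lam f = ∀ (i : Fin s) → lam i ≤ BlockSize f i

module Container {n s : ℕ} (lam : Fin s → ℕ) (f : Fin n → Fin s) where

  -- rank x = r  iff  x is the r-th smallest element of its block (r ≥ 1)
  rank : Fin n → ℕ
  rank x = count (λ y → (y Fin.≤? x) ×-dec (f y Fin.≟ f x))

  Floating : Fin n → Set
  Floating x = lam (f x) < rank x

  floating? : Decidable Floating
  floating? x = lam (f x) ℕ.<? rank x

  -- container row (numbered from the top, starting at 1) of a non-floating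
  -- element: the r-th smallest sits in row lam - r + 1
  row : Fin n → ℕ
  row x = suc (lam (f x) ∸ rank x)

  CoinvA CoinvB CoinvC Coinv : Fin n → Fin n → Set
  CoinvA x y = Floating x × x Fin.< y × f x Fin.< f y × ¬ Floating y × row y ≡ 1
  CoinvB x y = ¬ Floating x × x Fin.< y × f x Fin.< f y × ¬ Floating y × row y ≡ row x
  CoinvC x y = ¬ Floating x × x Fin.< y × f y Fin.< f x × ¬ Floating y × row y ≡ suc (row x)
  Coinv x y = CoinvA x y ⊎ CoinvB x y ⊎ CoinvC x y

  coinv? : ∀ x → Decidable (Coinv x)
  coinv? x y =
    (floating? x ×-dec x Fin.<? y ×-dec f x Fin.<? f y ×-dec ¬? (floating? y) ×-dec row y ℕ.≟ 1)
    ⊎-dec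
    (¬? (floating? x) ×-dec x Fin.<? y ×-dec f x Fin.<? f y ×-dec ¬? (floating? y) ×-dec row y ℕ.≟ row x)
    ⊎-dec
    (¬? (floating? x) ×-dec x Fin.<? y ×-dec f y Fin.<? f x ×-dec ¬? (floating? y) ×-dec row y ℕ.≟ suc (row x))

  -- c_x = #{y > x : (x,y) coinversion} + (p - 1) if x floats in block p (1-indexed)
  codeAt : Fin n → ℕ
  codeAt x = count (coinv? x) + (if ⌊ floating? x ⌋ then toℕ (f x) else 0)

code : ∀ {n s} → (Fin s → ℕ) → (Fin n → Fin s) → List ℕ
code {n} lam f = map (Container.codeAt lam f) (allFin n)

data Shuffle : List (List ℕ) → List ℕ → Set where
  []  : Shuffle [] []
  _∷_ : ∀ {l ls w' w} → Interleaving l w' w → Shuffle ls w' → Shuffle (l ∷ ls) w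

codeSeqs : (n k s : ℕ) → (Fin s → ℕ) → List (List ℕ)
codeSeqs n k s lam =
  map (λ j → downFrom (conj lam (suc j))) (upTo k) ++ (replicate (n ∸ k) (s ∸ 1) ∷ [])

InC : (n k s : ℕ) → (Fin s → ℕ) → List ℕ → Set
InC n k s lam c = ∃ λ w → Shuffle (codeSeqs n k s lam) w × Pointwise _≤_ c w

module Submission where

-- The proof is an induction on n which removes the smallest element of σ.
-- If it lies in block p, its code entry equals the rank of p in a total
-- order on blocks (longer columns first; among equally long nonempty columns
-- the right one first, among empty columns the left one first).  Deleting the element together with the bottom
-- box of column p gives an element of OP_{n-1,λ⁻} whose code is the rest of
-- the code of σ (Removal).
-- On the other side, C_{n,λ} is described recursively by Fits: a code is
-- read one entry at a time, either from one of the staircases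
-- (λ'_j - 1, …, 1, 0) or as a constant entry s - 1 (fits⇒shuffle,
-- shuffle⇒fits).  Two exchange lemmas (fits-lowerShorter, fits-toConst) show
-- that once the entry rank p has been read, the rest fits the staircases of
-- λ⁻.

open import Defs
open import Data.Nat as ℕ using (ℕ; zero; suc; _+_; _∸_; _≤_; _<_; z≤n; s≤s)
import Data.Nat.Properties as NP
open import Data.Nat.ListAction using (sum)
open import Data.Fin as Fin using (Fin; toℕ)
import Data.Fin.Properties as FP
open import Data.List.Properties using (∷-injective; ∷-injectiveˡ; ∷-injectiveʳ; map-tabulate; tabulate-cong)
open import Data.List using (List; []; _∷_; _++_; map; length; filter; tabulate; allFin; downFrom; upTo; applyUpTo; replicate)
open import Data.List.Relation.Unary.All using (All; []; _∷_)
open import Data.List.Relation.Binary.Pointwise using (Pointwise; []; _∷_)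
open import Data.List.Relation.Ternary.Interleaving.Propositional using (consˡ; consʳ)
open import Data.List.Relation.Ternary.Interleaving using ([])
open import Data.Product using (Σ; _×_; _,_; proj₁; proj₂)
open import Data.Sum using (_⊎_; inj₁; inj₂; [_,_]′)
open import Data.Empty using (⊥-elim)
open import Data.Bool using (true; false; if_then_else_)
open import Function using (_∘_)
import Data.Vec.Functional as Vector
open import Relation.Nullary using (¬_; Dec; yes; no; ⌊_⌋; ¬?; _×-dec_; _⊎-dec_)
open import Relation.Unary using (Pred; Decidable)
open import Relation.Binary.Definitions using (DecidableEquality; tri<; tri≈; tri>)
open import Relation.Binary.PropositionalEquality
  using (_≡_; refl; sym; trans; cong; cong₂; subst; subst₂; _≢_; module ≡-Reasoning)
open import Data.Nat.Tactic.RingSolver using (solve-∀)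

χ : ∀ {p} {P : Set p} → Dec P → ℕ
χ (yes _) = 1
χ (no _)  = 0

χ-cong : ∀ {p q} {P : Set p} {Q : Set q} → (P → Q) → (Q → P) → (d : Dec P) (e : Dec Q) → χ d ≡ χ e
χ-cong f g (yes x) (yes y) = refl
χ-cong f g (yes x) (no ¬y) = ⊥-elim (¬y (f x))
χ-cong f g (no ¬x) (yes y) = ⊥-elim (¬x (g y))
χ-cong f g (no ¬x) (no ¬y) = refl

χ-yes : ∀ {p} {P : Set p} → P → (d : Dec P) → χ d ≡ 1
χ-yes x (yes _) = refl
χ-yes x (no ¬x) = ⊥-elim (¬x x)

χ-no : ∀ {p} {P : Set p} → ¬ P → (d : Dec P) → χ d ≡ 0
χ-no ¬x (yes x) = ⊥-elim (¬x x)
χ-no ¬x (no _)  = refl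

χ≤1 : ∀ {p} {P : Set p} (d : Dec P) → χ d ≤ 1
χ≤1 (yes _) = s≤s z≤n
χ≤1 (no _)  = z≤n

χ-mono : ∀ {p q} {P : Set p} {Q : Set q} → (P → Q) → (d : Dec P) (e : Dec Q) → χ d ≤ χ e
χ-mono f (yes x) (yes y) = NP.≤-refl
χ-mono f (yes x) (no ¬y) = ⊥-elim (¬y (f x))
χ-mono f (no _)  e       = z≤n

χ-split : ∀ {p r} {P : Set p} {R : Set r} (d : Dec P) (e : Dec R) → χ d ≡ χ (d ×-dec e) + χ (d ×-dec ¬? e)
χ-split (yes _) (yes _) = refl
χ-split (yes _) (no _)  = refl
χ-split (no _)  (yes _) = refl
χ-split (no _)  (no _)  = refl

χ-⊎ : ∀ {p r} {P : Set p} {R : Set r} (d : Dec P) (e : Dec R) → ¬ (P × R) → χ (d ⊎-dec e) ≡ χ d + χ e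
χ-⊎ (yes x) (yes y) disj = ⊥-elim (disj (x , y))
χ-⊎ (yes _) (no _)  disj = refl
χ-⊎ (no _)  (yes _) disj = refl
χ-⊎ (no _)  (no _)  disj = refl

χ-× : ∀ {p q} {P : Set p} {Q : Set q} (d : Dec P) (e : Dec Q) → χ (d ×-dec e) ≡ χ d ℕ.* χ e
χ-× (yes _) (yes _) = refl
χ-× (yes _) (no _)  = refl
χ-× (no _)  (yes _) = refl
χ-× (no _)  (no _)  = refl

⌊⌋-cong : ∀ {p q} {P : Set p} {Q : Set q} → (P → Q) → (Q → P) → (d : Dec P) (e : Dec Q) → ⌊ d ⌋ ≡ ⌊ e ⌋
⌊⌋-cong f g (yes x) (yes y) = refl
⌊⌋-cong f g (yes x) (no ¬y) = ⊥-elim (¬y (f x))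
⌊⌋-cong f g (no ¬x) (yes y) = ⊥-elim (¬x (g y))
⌊⌋-cong f g (no ¬x) (no ¬y) = refl

⌊⌋-yes : ∀ {p} {P : Set p} → P → (d : Dec P) → ⌊ d ⌋ ≡ true
⌊⌋-yes x (yes _) = refl
⌊⌋-yes x (no ¬x) = ⊥-elim (¬x x)

⌊⌋-no : ∀ {p} {P : Set p} → ¬ P → (d : Dec P) → ⌊ d ⌋ ≡ false
⌊⌋-no ¬x (yes x) = ⊥-elim (¬x x)
⌊⌋-no ¬x (no _)  = refl

∑ : ∀ n → (Fin n → ℕ) → ℕ
∑ zero    g = 0
∑ (suc n) g = g Fin.zero + ∑ n (g ∘ Fin.suc)

count≡∑ : ∀ {n} {P : Pred (Fin n) Agda.Primitive.lzero} (P? : Decidable P) → count P? ≡ ∑ n (χ ∘ P?)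
count≡∑ {n} P? = go n (λ x → x)
  where
  go : ∀ m (g : Fin m → Fin n) → length (filter P? (tabulate g)) ≡ ∑ m (χ ∘ P? ∘ g)
  go zero    g = refl
  go (suc m) g with P? (g Fin.zero)
  ... | yes _ = cong suc (go m (g ∘ Fin.suc))
  ... | no _  = go m (g ∘ Fin.suc)

sum-allFin : ∀ n (g : Fin n → ℕ) → sum (map g (allFin n)) ≡ ∑ n g
sum-allFin n g = trans (cong sum (map-tabulate (λ x → x) g)) (go n g)
  where
  go : ∀ m (h : Fin m → ℕ) → sum (tabulate h) ≡ ∑ m h
  go zero    h = refl
  go (suc m) h = cong (h Fin.zero +_) (go m (h ∘ Fin.suc))

∑-cong : ∀ n {g h : Fin n → ℕ} → (∀ x → g x ≡ h x) → ∑ n g ≡ ∑ n h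
∑-cong zero    e = refl
∑-cong (suc n) e = cong₂ _+_ (e Fin.zero) (∑-cong n (e ∘ Fin.suc))

∑-mono : ∀ n {g h : Fin n → ℕ} → (∀ x → g x ≤ h x) → ∑ n g ≤ ∑ n h
∑-mono zero    e = z≤n
∑-mono (suc n) e = NP.+-mono-≤ (e Fin.zero) (∑-mono n (e ∘ Fin.suc))

∑-strictMono : ∀ n {g h : Fin n → ℕ} → (∀ x → g x ≤ h x) → (p : Fin n) → g p < h p → ∑ n g < ∑ n h
∑-strictMono (suc n) e Fin.zero    lt = NP.+-mono-<-≤ lt (∑-mono n (e ∘ Fin.suc))
∑-strictMono (suc n) e (Fin.suc p) lt = NP.+-mono-≤-< (e Fin.zero) (∑-strictMono n (e ∘ Fin.suc) p lt)

∑-term≤ : ∀ n (g : Fin n → ℕ) (p : Fin n) → g p ≤ ∑ n g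
∑-term≤ (suc n) g Fin.zero    = NP.m≤m+n _ _
∑-term≤ (suc n) g (Fin.suc p) = NP.≤-trans (∑-term≤ n (g ∘ Fin.suc) p) (NP.m≤n+m _ _)

∑-zero : ∀ n {g : Fin n → ℕ} → (∀ x → g x ≡ 0) → ∑ n g ≡ 0
∑-zero zero    e = refl
∑-zero (suc n) e = cong₂ _+_ (e Fin.zero) (∑-zero n (e ∘ Fin.suc))

∑-pos⇒nonempty : ∀ n (g : Fin n → ℕ) → 1 ≤ ∑ n g → 1 ≤ n
∑-pos⇒nonempty (suc n) g _ = s≤s z≤n

∑-ones : ∀ n → ∑ n (λ _ → 1) ≡ n
∑-ones zero    = refl
∑-ones (suc n) = cong suc (∑-ones n)

∑-+ : ∀ n (g h : Fin n → ℕ) → ∑ n (λ x → g x + h x) ≡ ∑ n g + ∑ n h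
∑-+ zero    g h = refl
∑-+ (suc n) g h = trans (cong (g Fin.zero + h Fin.zero +_) (∑-+ n (g ∘ Fin.suc) (h ∘ Fin.suc)))
                        (interchange (g Fin.zero) (h Fin.zero) _ _)
  where
  interchange : ∀ a b c d → (a + b) + (c + d) ≡ (a + c) + (b + d)
  interchange = solve-∀

∑-changeOne : ∀ n (g h : Fin n → ℕ) (p : Fin n) → (∀ q → q ≢ p → g q ≡ h q) → ∑ n g + h p ≡ ∑ n h + g p
∑-changeOne (suc n) g h Fin.zero e =
  trans (cong (λ t → g Fin.zero + t + h Fin.zero) (∑-cong n (λ q → e (Fin.suc q) (λ ()))))
        (rotate (g Fin.zero) _ (h Fin.zero))
  where
  rotate : ∀ a b c → (a + b) + c ≡ (c + b) + a
  rotate = solve-∀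
∑-changeOne (suc n) g h (Fin.suc p) e = begin
  g Fin.zero + ∑ n (g ∘ Fin.suc) + h (Fin.suc p)     ≡⟨ cong (λ a → a + ∑ n (g ∘ Fin.suc) + h (Fin.suc p)) (e Fin.zero (λ ())) ⟩
  h Fin.zero + ∑ n (g ∘ Fin.suc) + h (Fin.suc p)     ≡⟨ NP.+-assoc (h Fin.zero) _ _ ⟩
  h Fin.zero + (∑ n (g ∘ Fin.suc) + h (Fin.suc p))   ≡⟨ cong (h Fin.zero +_) (∑-changeOne n (g ∘ Fin.suc) (h ∘ Fin.suc) p
                                                           (λ q q≢p → e (Fin.suc q) (q≢p ∘ FP.suc-injective))) ⟩
  h Fin.zero + (∑ n (h ∘ Fin.suc) + g (Fin.suc p))   ≡⟨ NP.+-assoc (h Fin.zero) _ _ ⟨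
  h Fin.zero + ∑ n (h ∘ Fin.suc) + g (Fin.suc p)     ∎
  where open ≡-Reasoning

∑-split : ∀ n {P R : Pred (Fin n) Agda.Primitive.lzero} (P? : Decidable P) (R? : Decidable R) →
  ∑ n (χ ∘ P?) ≡ ∑ n (λ q → χ (P? q ×-dec R? q)) + ∑ n (λ q → χ (P? q ×-dec ¬? (R? q)))
∑-split n P? R? = trans (∑-cong n (λ q → χ-split (P? q) (R? q))) (∑-+ n _ _)

∑-below : ∀ n (p : Fin n) → ∑ n (λ q → χ (q Fin.<? p)) ≡ toℕ p
∑-below (suc n) Fin.zero    = ∑-zero (suc n) (λ q → χ-no (λ ()) (q Fin.<? Fin.zero {n}))
∑-below (suc n) (Fin.suc p) = cong₂ _+_ (χ-yes (s≤s z≤n) (Fin.zero {n} Fin.<? Fin.suc p))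
  (trans (∑-cong n (λ q → χ-cong (λ { (s≤s q<p) → q<p }) s≤s (Fin.suc q Fin.<? Fin.suc p) (q Fin.<? p))) (∑-below n p))

<⇒≤∸1 : ∀ {a b} → a < b → a ≤ b ∸ 1
<⇒≤∸1 {b = suc b} (s≤s a≤b) = a≤b

suc∸1 : ∀ {b} → 1 ≤ b → suc (b ∸ 1) ≡ b
suc∸1 {suc b} _ = refl

≤suc⇒∸1≤ : ∀ a {b} → a ≤ suc b → a ∸ 1 ≤ b
≤suc⇒∸1≤ zero    _         = z≤n
≤suc⇒∸1≤ (suc a) (s≤s a≤b) = a≤b

∸1≤⇒≤suc : ∀ a {b} → a ∸ 1 ≤ b → a ≤ suc b
∸1≤⇒≤suc zero    _   = z≤n
∸1≤⇒≤suc (suc a) a≤b = s≤s a≤b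

module PointLowering {A : Set} (_≟_ : DecidableEquality A) where

  lowerAt : (A → ℕ) → A → A → ℕ
  lowerAt h a x with x ≟ a
  ... | yes _ = h x ∸ 1
  ... | no _  = h x

  lowerAt-here : ∀ h a → lowerAt h a a ≡ h a ∸ 1
  lowerAt-here h a with a ≟ a
  ... | yes _  = refl
  ... | no a≢a = ⊥-elim (a≢a refl)

  lowerAt-else : ∀ h a x → x ≢ a → lowerAt h a x ≡ h x
  lowerAt-else h a x x≢a with x ≟ a
  ... | yes x≡a = ⊥-elim (x≢a x≡a)
  ... | no _    = refl

  lowerAt-≤ : ∀ h a x → lowerAt h a x ≤ h x
  lowerAt-≤ h a x with x ≟ a
  ... | yes _ = NP.m∸n≤m (h x) 1
  ... | no _  = NP.≤-refl

  lowerAt-at : ∀ h a x → x ≡ a → lowerAt h a x ≡ h x ∸ 1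
  lowerAt-at h a .a refl = lowerAt-here h a

  lowerAt-comm : ∀ h a b x → lowerAt (lowerAt h a) b x ≡ lowerAt (lowerAt h b) a x
  lowerAt-comm h a b x = cases (x ≟ a) (x ≟ b)
    where
    cases : Dec (x ≡ a) → Dec (x ≡ b) → lowerAt (lowerAt h a) b x ≡ lowerAt (lowerAt h b) a x
    cases (yes x≡a) (yes x≡b) =
      trans (lowerAt-at _ b x x≡b) (trans (cong (_∸ 1) (lowerAt-at h a x x≡a))
        (sym (trans (lowerAt-at _ a x x≡a) (cong (_∸ 1) (lowerAt-at h b x x≡b)))))
    cases (yes x≡a) (no x≢b) =
      trans (lowerAt-else _ b x x≢b) (trans (lowerAt-at h a x x≡a)
        (sym (trans (lowerAt-at _ a x x≡a) (cong (_∸ 1) (lowerAt-else h b x x≢b)))))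
    cases (no x≢a) (yes x≡b) =
      trans (lowerAt-at _ b x x≡b) (trans (cong (_∸ 1) (lowerAt-else h a x x≢a))
        (sym (trans (lowerAt-else _ a x x≢a) (lowerAt-at h b x x≡b))))
    cases (no x≢a) (no x≢b) =
      trans (lowerAt-else _ b x x≢b) (trans (lowerAt-else h a x x≢a)
        (sym (trans (lowerAt-else _ a x x≢a) (lowerAt-else h b x x≢b))))

-- Heights h : ℕ → ℕ describe the staircases
-- (h j - 1, …, 1, 0) still available and m counts the remaining constant
-- entries s - 1.  Fits s h m c says that c is dominated entrywise by a word
-- obtained by repeatedly taking the next entry of some staircase or a
-- constant entry.  It is the recursive form of the code set C_{n,λ}
-- (fits⇒inC, inC⇒fits), and the one the recursion on n works with.

Heights : Set
Heights = ℕ → ℕ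

open PointLowering ℕ._≟_ public using () renaming
  (lowerAt to lower; lowerAt-here to lower-here; lowerAt-else to lower-else; lowerAt-at to lower-at;
   lowerAt-≤ to lower-≤; lowerAt-comm to lower-comm)

data Fits (s : ℕ) : Heights → ℕ → List ℕ → Set where
  done  : ∀ {h} → (∀ j → h j ≡ 0) → Fits s h 0 []
  stair : ∀ {h m a c} (j : ℕ) → a < h j → Fits s (lower h j) m c → Fits s h m (a ∷ c)
  const : ∀ {h m a c} → a ≤ s ∸ 1 → Fits s h m c → Fits s h (suc m) (a ∷ c)

transpose : ℕ → ℕ → ℕ → ℕ
transpose j j' i with i ℕ.≟ j
... | yes _ = j'
... | no _ with i ℕ.≟ j'
...   | yes _ = j
...   | no _  = i

transpose-left : ∀ j j' → transpose j j' j ≡ j'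
transpose-left j j' with j ℕ.≟ j
... | yes _  = refl
... | no j≢j = ⊥-elim (j≢j refl)

transpose-right : ∀ j j' → transpose j j' j' ≡ j
transpose-right j j' with j' ℕ.≟ j
... | yes j'≡j = j'≡j
... | no _ with j' ℕ.≟ j'
...   | yes _     = refl
...   | no j'≢j' = ⊥-elim (j'≢j' refl)

transpose-else : ∀ j j' i → i ≢ j → i ≢ j' → transpose j j' i ≡ i
transpose-else j j' i i≢j i≢j' with i ℕ.≟ j
... | yes i≡j = ⊥-elim (i≢j i≡j)
... | no _ with i ℕ.≟ j'
...   | yes i≡j' = ⊥-elim (i≢j' i≡j')
...   | no _     = refl

transpose-involutive : ∀ j j' i → transpose j j' (transpose j j' i) ≡ i
transpose-involutive j j' i with i ℕ.≟ j
... | yes refl = transpose-right j j'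
... | no i≢j with i ℕ.≟ j'
...   | yes refl = transpose-left j j'
...   | no i≢j'  = transpose-else j j' i i≢j i≢j'

module _ {s : ℕ} where

  -- Fits only sees the multiset of heights: relabelling the staircases by an
  -- involution τ preserves it
  fits-relabel : ∀ {h m c} → Fits s h m c → (τ : ℕ → ℕ) → (∀ i → τ (τ i) ≡ i) →
                 ∀ h₂ → (∀ i → h₂ i ≡ h (τ i)) → Fits s h₂ m c
  fits-relabel (done z)    τ inv h₂ e = done (λ i → trans (e i) (z (τ i)))
  fits-relabel (const b d) τ inv h₂ e = const b (fits-relabel d τ inv h₂ e)
  fits-relabel {h} (stair j b d) τ inv h₂ e =
    stair (τ j) (subst (_ <_) (sym (trans (e (τ j)) (cong h (inv j)))) b)
      (fits-relabel d τ inv (lower h₂ (τ j)) (λ x → lowered x (x ℕ.≟ τ j)))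
    where
    lowered : ∀ x → Dec (x ≡ τ j) → lower h₂ (τ j) x ≡ lower h j (τ x)
    lowered x (yes x≡τj) = trans (lower-at h₂ (τ j) x x≡τj)
      (trans (cong (_∸ 1) (e x)) (sym (lower-at h j (τ x) (trans (cong τ x≡τj) (inv j)))))
    lowered x (no x≢τj) = trans (lower-else h₂ (τ j) x x≢τj)
      (trans (e x) (sym (lower-else h j (τ x) (λ τx≡j → x≢τj (trans (sym (inv x)) (cong τ τx≡j))))))

  fits-ext : ∀ {h m c} → Fits s h m c → ∀ h₂ → (∀ i → h₂ i ≡ h i) → Fits s h₂ m c
  fits-ext d h₂ e = fits-relabel d (λ i → i) (λ i → refl) h₂ e

  fits-lowerEqual : ∀ {h m c} j j' → h j ≡ h j' → Fits s (lower h j') m c → Fits s (lower h j) m c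
  fits-lowerEqual {h} j j' hj≡hj' d =
    fits-relabel d (transpose j j') (transpose-involutive j j') (lower h j) (λ x → swapped x (x ℕ.≟ j) (x ℕ.≟ j'))
    where
    swapped : ∀ x → Dec (x ≡ j) → Dec (x ≡ j') → lower h j x ≡ lower h j' (transpose j j' x)
    swapped x (yes refl) _ = trans (lower-here h x)
      (trans (cong (_∸ 1) hj≡hj') (trans (sym (lower-here h j')) (cong (lower h j') (sym (transpose-left x j')))))
    swapped x (no x≢j) (yes refl) = trans (lower-else h j x x≢j)
      (trans (sym hj≡hj') (trans (sym (lower-else h x j (x≢j ∘ sym))) (cong (lower h x) (sym (transpose-right j x)))))
    swapped x (no x≢j) (no x≢j') = trans (lower-else h j x x≢j)
      (trans (sym (lower-else h j' x x≢j')) (cong (lower h j') (sym (transpose-else j j' x x≢j x≢j'))))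

  MovesUnit : ℕ → ℕ → Heights → Heights → Set
  MovesUnit j j' h h₂ = h₂ j ≡ h j ∸ 1 × h₂ j' ≡ suc (h j') × (∀ i → i ≢ j → i ≢ j' → h₂ i ≡ h i)

  movesUnit-takeFrom : ∀ {j j' h h₂} → j ≢ j' → MovesUnit j j' h h₂ → ∀ x → lower h₂ j' x ≡ lower h j x
  movesUnit-takeFrom {j} {j'} {h} {h₂} j≢j' (at-j , at-j' , elsewhere) x = cases (x ℕ.≟ j) (x ℕ.≟ j')
    where
    cases : Dec (x ≡ j) → Dec (x ≡ j') → lower h₂ j' x ≡ lower h j x
    cases (yes refl) _ = trans (lower-else h₂ j' x j≢j') (trans at-j (sym (lower-here h x)))
    cases (no x≢j) (yes refl) = trans (lower-here h₂ x) (trans (cong (_∸ 1) at-j') (sym (lower-else h j x x≢j)))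
    cases (no x≢j) (no x≢j') =
      trans (lower-else h₂ j' x x≢j') (trans (elsewhere x x≢j x≢j') (sym (lower-else h j x x≢j)))

  movesUnit-lowerTarget : ∀ {j j' h h₂} → j ≢ j' → 1 ≤ h j' → MovesUnit j j' h h₂ → MovesUnit j j' (lower h j') (lower h₂ j')
  movesUnit-lowerTarget {j} {j'} {h} {h₂} j≢j' 1≤hj' (at-j , at-j' , elsewhere) =
    trans (lower-else h₂ j' j j≢j') (trans at-j (cong (_∸ 1) (sym (lower-else h j' j j≢j')))) ,
    trans (lower-here h₂ j') (trans (cong (_∸ 1) at-j')
      (trans (sym (suc∸1 1≤hj')) (cong suc (sym (lower-here h j'))))) ,
    λ i i≢j i≢j' → trans (lower-else h₂ j' i i≢j') (trans (elsewhere i i≢j i≢j') (sym (lower-else h j' i i≢j')))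

  movesUnit-lowerOther : ∀ {j j' h h₂} i → i ≢ j → i ≢ j' → MovesUnit j j' h h₂ → MovesUnit j j' (lower h i) (lower h₂ i)
  movesUnit-lowerOther {j} {j'} {h} {h₂} i i≢j i≢j' (at-j , at-j' , elsewhere) =
    trans (lower-else h₂ i j (i≢j ∘ sym)) (trans at-j (cong (_∸ 1) (sym (lower-else h i j (i≢j ∘ sym))))) ,
    trans (lower-else h₂ i j' (i≢j' ∘ sym)) (trans at-j' (cong suc (sym (lower-else h i j' (i≢j' ∘ sym))))) ,
    λ k k≢j k≢j' → cases k (k ℕ.≟ i) (elsewhere k k≢j k≢j')
    where
    cases : ∀ k → Dec (k ≡ i) → h₂ k ≡ h k → lower h₂ i k ≡ lower h i k
    cases k (yes k≡i) e = trans (lower-at h₂ i k k≡i) (trans (cong (_∸ 1) e) (sym (lower-at h i k k≡i)))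
    cases k (no k≢i)  e = trans (lower-else h₂ i k k≢i) (trans e (sym (lower-else h i k k≢i)))

  -- Exchange lemma: moving a unit from a nonempty staircase to one at least as
  -- tall keeps a code fitting (the longer staircase dominates entrywise).
  fits-moveUnit : ∀ {h m c} → Fits s h m c → ∀ {j j' h₂} → j ≢ j' → 1 ≤ h j → h j ≤ h j' →
                  MovesUnit j j' h h₂ → Fits s h₂ m c
  fits-moveUnit (done z) j≢j' 1≤hj _ _ = ⊥-elim (NP.<⇒≢ 1≤hj (sym (z _)))
  fits-moveUnit (const b d) j≢j' 1≤hj hj≤hj' mv = const b (fits-moveUnit d j≢j' 1≤hj hj≤hj' mv)
  fits-moveUnit {h} (stair i b d) {j} {j'} j≢j' 1≤hj hj≤hj' mv@(_ , at-j' , _) with i ℕ.≟ j | i ℕ.≟ j'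
  -- an entry read from the source j can be read from the (taller) target j' instead
  ... | yes refl | _ = stair j' (subst (_ <_) (sym at-j') (NP.m<n⇒m<1+n (NP.<-≤-trans b hj≤hj')))
          (fits-ext d _ (movesUnit-takeFrom j≢j' mv))
  -- an entry read from the target: if it stays at least as tall as the source the
  -- move is postponed, otherwise source and target have become interchangeable
  ... | no i≢j | yes refl with NP.m≤n⇒m<n∨m≡n hj≤hj'
  ...   | inj₁ hj<hj' = stair j' (subst (_ <_) (sym at-j') (NP.m<n⇒m<1+n b))
          (fits-moveUnit d j≢j'
            (subst (1 ≤_) (sym (lower-else h j' j j≢j')) 1≤hj)
            (subst₂ _≤_ (sym (lower-else h j' j j≢j')) (sym (lower-here h j')) (<⇒≤∸1 hj<hj'))
            (movesUnit-lowerTarget j≢j' (NP.≤-<-trans z≤n b) mv))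
  ...   | inj₂ hj≡hj' = stair j' (subst (_ <_) (sym at-j') (NP.m<n⇒m<1+n b))
          (fits-ext (fits-lowerEqual j j' hj≡hj' d) _ (movesUnit-takeFrom j≢j' mv))
  fits-moveUnit {h} (stair i b d) {j} {j'} j≢j' 1≤hj hj≤hj' mv | no i≢j | no i≢j' =
    stair i (subst (_ <_) (sym (proj₂ (proj₂ mv) i i≢j i≢j')) b)
      (fits-moveUnit d j≢j' (subst (1 ≤_) (sym (lower-else h i j (i≢j ∘ sym))) 1≤hj)
        (subst₂ _≤_ (sym (lower-else h i j (i≢j ∘ sym))) (sym (lower-else h i j' (i≢j' ∘ sym))) hj≤hj')
        (movesUnit-lowerOther i i≢j i≢j' mv))

  fits-lowerShorter : ∀ {h m c} j l → 1 ≤ h l → h l ≤ h j → Fits s (lower h j) m c → Fits s (lower h l) m c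
  fits-lowerShorter {h} j l 1≤hl hl≤hj d with l ℕ.≟ j
  ... | yes refl = d
  ... | no l≢j with NP.m≤n⇒m<n∨m≡n hl≤hj
  ...   | inj₂ hl≡hj = fits-lowerEqual l j hl≡hj d
  ...   | inj₁ hl<hj = fits-moveUnit d l≢j
          (subst (1 ≤_) (sym (lower-else h j l l≢j)) 1≤hl)
          (subst₂ _≤_ (sym (lower-else h j l l≢j)) (sym (lower-here h j)) (<⇒≤∸1 hl<hj))
          ( trans (lower-here h l) (cong (_∸ 1) (sym (lower-else h j l l≢j)))
          , trans (lower-else h l j (l≢j ∘ sym))
              (trans (sym (suc∸1 (NP.≤-trans 1≤hl hl≤hj))) (cong suc (sym (lower-here h j))))
          , λ i i≢l i≢j → trans (lower-else h l i i≢l) (sym (lower-else h j i i≢j)))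

  fits-toConst : ∀ {h m c} → Fits s h m c → ∀ j → 1 ≤ h j → h j ≤ s → Fits s (lower h j) (suc m) c
  fits-toConst (done z)    j 1≤hj hj≤s = ⊥-elim (NP.<⇒≢ 1≤hj (sym (z j)))
  fits-toConst (const b d) j 1≤hj hj≤s = const b (fits-toConst d j 1≤hj hj≤s)
  fits-toConst {h} (stair i b d) j 1≤hj hj≤s with i ℕ.≟ j
  ... | yes refl = const (<⇒≤∸1 (NP.<-≤-trans b hj≤s)) d
  ... | no i≢j = stair i (subst (_ <_) (sym (lower-else h j i i≢j)) b)
          (fits-ext (fits-toConst d j (subst (1 ≤_) (sym (lower-else h i j (i≢j ∘ sym))) 1≤hj)
                                      (subst (_≤ s) (sym (lower-else h i j (i≢j ∘ sym))) hj≤s))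
                    _ (lower-comm h j i))

data Pick : List (List ℕ) → ℕ → List (List ℕ) → Set where
  here  : ∀ {x w ws} → Pick ((x ∷ w) ∷ ws) x (w ∷ ws)
  there : ∀ {w ws x ws'} → Pick ws x ws' → Pick (w ∷ ws) x (w ∷ ws')

pick⇒shuffle : ∀ {ws x ws' w} → Pick ws x ws' → Shuffle ws' w → Shuffle ws (x ∷ w)
pick⇒shuffle here       (i ∷ sh) = consˡ i ∷ sh
pick⇒shuffle (there pk) (i ∷ sh) = consʳ i ∷ pick⇒shuffle pk sh

shuffle⇒pick : ∀ {ws x w} → Shuffle ws (x ∷ w) → Σ (List (List ℕ)) (λ ws' → Pick ws x ws' × Shuffle ws' w)
shuffle⇒pick (consˡ i ∷ sh) = _ , here , i ∷ sh
shuffle⇒pick (consʳ i ∷ sh) with shuffle⇒pick sh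
... | _ , pk , sh' = _ , there pk , i ∷ sh'

shuffle-[] : ∀ {ws} → Shuffle ws [] → All (_≡ []) ws
shuffle-[] []        = []
shuffle-[] ([] ∷ sh) = refl ∷ shuffle-[] sh

range : ℕ → ℕ → List ℕ
range a zero    = []
range a (suc K) = a ∷ range (suc a) K

emptyRange : ∀ {a j} → a ≤ j → ¬ j < a + 0
emptyRange {a} a≤j j<a+0 = NP.<-irrefl refl (NP.<-≤-trans j<a+0 (subst (_≤ _) (sym (NP.+-identityʳ a)) a≤j))

upTo≡range : ∀ K → upTo K ≡ range 0 K
upTo≡range K = go K (λ i → i) 0 (λ i → refl)
  where
  go : ∀ K (g : ℕ → ℕ) a → (∀ i → g i ≡ a + i) → applyUpTo g K ≡ range a K
  go zero    g a e = refl
  go (suc K) g a e = cong₂ _∷_ (trans (e 0) (NP.+-identityʳ a))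
    (go K (g ∘ suc) (suc a) (λ i → trans (e (suc i)) (NP.+-suc a i)))

downFrom-∷ : ∀ x {y w} → downFrom x ≡ y ∷ w → x ≡ suc y × w ≡ downFrom y
downFrom-∷ (suc x) refl = refl , refl

downFrom-[] : ∀ x → downFrom x ≡ [] → x ≡ 0
downFrom-[] zero _ = refl

module Staircases (s : ℕ) where

  Stairs : Heights → ℕ → ℕ → ℕ → List (List ℕ)
  Stairs h a K m = map (downFrom ∘ h) (range a K) ++ (replicate m (s ∸ 1) ∷ [])

  stairs-cong : ∀ h h' a K m → (∀ i → a ≤ i → h i ≡ h' i) → Stairs h a K m ≡ Stairs h' a K m
  stairs-cong h h' a zero    m e = refl
  stairs-cong h h' a (suc K) m e = cong₂ _∷_ (cong downFrom (e a NP.≤-refl))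
    (stairs-cong h h' (suc a) K m (λ i a<i → e i (NP.<⇒≤ a<i)))

  stairs-lowerBelow : ∀ h j a K m → j < a → Stairs (lower h j) a K m ≡ Stairs h a K m
  stairs-lowerBelow h j a K m j<a = stairs-cong _ h a K m (λ i a≤i → lower-else h j i (λ i≡j → NP.<-irrefl (sym i≡j) (NP.<-≤-trans j<a a≤i)))

  PickFromStairs : Heights → ℕ → ℕ → ℕ → ℕ → List (List ℕ) → Set
  PickFromStairs h a K m x ws' =
      Σ ℕ (λ j → a ≤ j × h j ≡ suc x × ws' ≡ Stairs (lower h j) a K m)
    ⊎ Σ ℕ (λ m' → m ≡ suc m' × x ≡ s ∸ 1 × ws' ≡ Stairs h a K m')

  stairs-pick : ∀ h K a m {ws x ws'} → Pick ws x ws' → ws ≡ Stairs h a K m → PickFromStairs h a K m x ws'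
  stairs-pick h zero    a zero    here       ()
  stairs-pick h zero    a (suc m) here       refl = inj₂ (m , refl , refl , refl)
  stairs-pick h zero    a m       (there ()) refl
  stairs-pick h (suc K) a m       here       eq   =
    let (e-head , e-rest) = ∷-injective eq
        (ha≡ , w≡)        = downFrom-∷ (h a) (sym e-head)
    in inj₁ (a , NP.≤-refl , ha≡ , cong₂ _∷_
         (trans w≡ (cong downFrom (sym (trans (lower-here h a) (cong (_∸ 1) ha≡)))))
         (trans e-rest (sym (stairs-lowerBelow h a (suc a) K m (NP.n<1+n a)))))
  stairs-pick h (suc K) a m {w ∷ _} (there pk) eq =
    extend (∷-injectiveˡ eq) (stairs-pick h K (suc a) m pk (∷-injectiveʳ eq))
    where
    extend : ∀ {x ws'} → w ≡ downFrom (h a) → PickFromStairs h (suc a) K m x ws' → PickFromStairs h a (suc K) m x (w ∷ ws')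
    extend w≡ (inj₁ (j , a<j , hj≡ , ws'≡)) = inj₁ (j , NP.<⇒≤ a<j , hj≡ ,
      cong₂ _∷_ (trans w≡ (cong downFrom (sym (lower-else h j a (NP.<⇒≢ a<j))))) ws'≡)
    extend w≡ (inj₂ (m' , m≡ , x≡ , ws'≡)) = inj₂ (m' , m≡ , x≡ , cong₂ _∷_ w≡ ws'≡)

  stairs-pickStair : ∀ h K a m j x → a ≤ j → j < a + K → h j ≡ suc x → Pick (Stairs h a K m) x (Stairs (lower h j) a K m)
  stairs-pickStair h zero a m j x a≤j j<a+0 hj≡ = ⊥-elim (emptyRange a≤j j<a+0)
  stairs-pickStair h (suc K) a m j x a≤j j<a+K hj≡ with j ℕ.≟ a
  ... | yes refl = subst₂ (λ ws ws' → Pick ws x ws')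
          (cong (λ y → downFrom y ∷ Stairs h (suc j) K m) (sym hj≡))
          (cong₂ _∷_ (cong downFrom (sym (trans (lower-here h j) (cong (_∸ 1) hj≡))))
                     (sym (stairs-lowerBelow h j (suc j) K m (NP.n<1+n j))))
          here
  ... | no j≢a = subst (Pick (Stairs h a (suc K) m) x)
          (cong (λ y → downFrom y ∷ Stairs (lower h j) (suc a) K m) (sym (lower-else h j a (j≢a ∘ sym))))
          (there (stairs-pickStair h K (suc a) m j x (NP.≤∧≢⇒< a≤j (j≢a ∘ sym)) (subst (j <_) (NP.+-suc a K) j<a+K) hj≡))

  stairs-pickConst : ∀ h K a m → Pick (Stairs h a K (suc m)) (s ∸ 1) (Stairs h a K m)
  stairs-pickConst h zero    a m = here
  stairs-pickConst h (suc K) a m = there (stairs-pickConst h K (suc a) m)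

  stairs-shuffle-[] : ∀ h K a → (∀ j → h j ≡ 0) → Shuffle (Stairs h a K 0) []
  stairs-shuffle-[] h zero    a z = [] ∷ []
  stairs-shuffle-[] h (suc K) a z =
    subst (λ y → Shuffle (downFrom y ∷ Stairs h (suc a) K 0) []) (sym (z a)) ([] ∷ stairs-shuffle-[] h K (suc a) z)

  stairs-allEmpty : ∀ h K a m → All (_≡ []) (Stairs h a K m) → m ≡ 0 × (∀ j → a ≤ j → j < a + K → h j ≡ 0)
  stairs-allEmpty h zero    a zero    _        = refl , λ j a≤j j<a+0 → ⊥-elim (emptyRange a≤j j<a+0)
  stairs-allEmpty h zero    a (suc m) (() ∷ _)
  stairs-allEmpty h (suc K) a m (ha≡[] ∷ rest) with stairs-allEmpty h K (suc a) m rest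
  ... | m≡0 , vanish = m≡0 , λ j a≤j j<a+K → cases j a≤j j<a+K (j ℕ.≟ a)
    where
    cases : ∀ j → a ≤ j → j < a + suc K → Dec (j ≡ a) → h j ≡ 0
    cases j _   _      (yes refl) = downFrom-[] (h j) ha≡[]
    cases j a≤j j<a+K (no j≢a)   = vanish j (NP.≤∧≢⇒< a≤j (j≢a ∘ sym)) (subst (j <_) (NP.+-suc a K) j<a+K)

  module _ (K : ℕ) where

    Vanishing : Heights → Set
    Vanishing h = ∀ j → K ≤ j → h j ≡ 0

    vanishing-lower : ∀ h j → Vanishing h → Vanishing (lower h j)
    vanishing-lower h j v i K≤i = NP.n≤0⇒n≡0 (subst (lower h j i ≤_) (v i K≤i) (lower-≤ h j i))

    fits⇒shuffle : ∀ {h m c} → Fits s h m c → Vanishing h → Σ (List ℕ) (λ w → Shuffle (Stairs h 0 K m) w × Pointwise _≤_ c w)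
    fits⇒shuffle (done z) v = [] , stairs-shuffle-[] _ K 0 z , []
    fits⇒shuffle {h} (stair j a<hj d) v with fits⇒shuffle d (vanishing-lower h j v)
    ... | w , sh , c≤w = h j ∸ 1 ∷ w ,
          pick⇒shuffle (stairs-pickStair h K 0 _ j (h j ∸ 1) z≤n j<K (sym (suc∸1 (NP.≤-<-trans z≤n a<hj)))) sh ,
          <⇒≤∸1 a<hj ∷ c≤w
      where
      j<K : j < K
      j<K = NP.≰⇒> (λ K≤j → NP.<⇒≢ (NP.≤-<-trans z≤n a<hj) (sym (v j K≤j)))
    fits⇒shuffle {h} (const a≤s-1 d) v with fits⇒shuffle d v
    ... | w , sh , c≤w = s ∸ 1 ∷ w , pick⇒shuffle (stairs-pickConst h K 0 _) sh , a≤s-1 ∷ c≤w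

    shuffle⇒fits : ∀ c w {h m} → Shuffle (Stairs h 0 K m) w → Pointwise _≤_ c w → Vanishing h → Fits s h m c
    shuffle⇒fits [] [] {h} sh [] v with stairs-allEmpty h K 0 _ (shuffle-[] sh)
    ... | refl , vanish = done (λ j → [ (λ K≤j → v j K≤j) , (λ j<K → vanish j z≤n j<K) ]′ (NP.≤-<-connex K j))
    shuffle⇒fits (a ∷ c) (x ∷ w) {h} {m} sh (a≤x ∷ c≤w) v with shuffle⇒pick sh
    ... | _ , pk , sh' with stairs-pick h K 0 m pk refl
    ...   | inj₁ (j , _ , hj≡ , ws'≡) = stair j (subst (a <_) (sym hj≡) (s≤s a≤x))
            (shuffle⇒fits c w (subst (λ ws → Shuffle ws w) ws'≡ sh') c≤w (vanishing-lower h j v))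
    ...   | inj₂ (m' , refl , refl , ws'≡) = const a≤x (shuffle⇒fits c w (subst (λ ws → Shuffle ws w) ws'≡ sh') c≤w v)

-- For σ = f on Fin (suc n), element 0 sits
-- in block p = f 0.  Deleting it (f⁻ = f ∘ suc) and lowering λ_p by one
-- (λ⁻ = lowerPart λ p) leaves the container diagram of every other element
-- unchanged: its rank and capacity either both stay or both drop by one.
-- Hence floating, rows, coinversions among later elements and their code
-- entries are unchanged, and σ ∈ OP_{n+1,λ} iff f⁻ ∈ OP_{n,λ⁻}.

lowerPart : ∀ {s} → (Fin s → ℕ) → Fin s → Fin s → ℕ
lowerPart = PointLowering.lowerAt Fin._≟_

module _ {s : ℕ} where
  open PointLowering (Fin._≟_ {s}) public using () renaming
    (lowerAt-here to lowerPart-here; lowerAt-else to lowerPart-else; lowerAt-at to lowerPart-at)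

module Removal {n s : ℕ} (lam : Fin s → ℕ) (f : Fin (suc n) → Fin s) where

  p : Fin s
  p = f Fin.zero

  f⁻ : Fin n → Fin s
  f⁻ = f ∘ Fin.suc

  lam⁻ : Fin s → ℕ
  lam⁻ = lowerPart lam p

  module C  = Container lam f
  module C⁻ = Container lam⁻ f⁻

  rank≡∑ : ∀ {m} (g : Fin m → Fin s) x → Container.rank lam g x ≡ ∑ m (λ y → χ ((y Fin.≤? x) ×-dec (g y Fin.≟ g x)))
  rank≡∑ g x = count≡∑ (λ y → (y Fin.≤? x) ×-dec (g y Fin.≟ g x))

  rank-zero : C.rank Fin.zero ≡ 1
  rank-zero = trans (rank≡∑ f Fin.zero) (cong₂ _+_
    (χ-yes (z≤n , refl) ((Fin.zero {n} Fin.≤? Fin.zero {n}) ×-dec (p Fin.≟ p)))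
    (∑-zero n (λ y → χ-no (λ { (() , _) }) ((Fin.suc y Fin.≤? Fin.zero {n}) ×-dec (f⁻ y Fin.≟ p)))))

  rank-suc : ∀ x → C.rank (Fin.suc x) ≡ χ (p Fin.≟ f⁻ x) + C⁻.rank x
  rank-suc x = trans (rank≡∑ f (Fin.suc x)) (cong₂ _+_ (χ-cong proj₂ (z≤n ,_) _ _)
    (trans (∑-cong n (λ y → χ-cong (λ { (s≤s y≤x , e) → y≤x , e }) (λ { (y≤x , e) → s≤s y≤x , e }) _ _))
           (sym (rank≡∑ f⁻ x))))

  rank⁻-pos : ∀ x → 1 ≤ C⁻.rank x
  rank⁻-pos x = subst (1 ≤_) (sym (rank≡∑ f⁻ x)) (NP.≤-trans (NP.≤-reflexive (sym (χ-yes (FP.≤-refl , refl) _))) (∑-term≤ n _ x))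

  Position : Fin n → Set
  Position x = (lam⁻ (f⁻ x) ≡ lam (f⁻ x) × C.rank (Fin.suc x) ≡ C⁻.rank x)
             ⊎ (lam⁻ (f⁻ x) ≡ lam (f⁻ x) ∸ 1 × C.rank (Fin.suc x) ≡ suc (C⁻.rank x))

  position : ∀ x → Position x
  position x = cases (f⁻ x Fin.≟ p)
    where
    cases : Dec (f⁻ x ≡ p) → Position x
    cases (yes fx≡p) = inj₂ (lowerPart-at lam p _ fx≡p , trans (rank-suc x) (cong (_+ C⁻.rank x) (χ-yes (sym fx≡p) _)))
    cases (no fx≢p)  = inj₁ (lowerPart-else lam p _ fx≢p , trans (rank-suc x) (cong (_+ C⁻.rank x) (χ-no (fx≢p ∘ sym) _)))

  floating-suc→ : ∀ x → C.Floating (Fin.suc x) → C⁻.Floating x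
  floating-suc→ x fl with position x
  ... | inj₁ (cap , rk) = subst₂ _<_ (sym cap) rk fl
  ... | inj₂ (cap , rk) = subst (_< C⁻.rank x) (sym cap) (shift (lam (f⁻ x)) (subst (lam (f⁻ x) <_) rk fl))
    where
    shift : ∀ l → l < suc (C⁻.rank x) → l ∸ 1 < C⁻.rank x
    shift zero    _           = rank⁻-pos x
    shift (suc l) (s≤s l<r)   = l<r

  floating-suc← : ∀ x → C⁻.Floating x → C.Floating (Fin.suc x)
  floating-suc← x fl with position x
  ... | inj₁ (cap , rk) = subst₂ _<_ cap (sym rk) fl
  ... | inj₂ (cap , rk) = subst (lam (f⁻ x) <_) (sym rk) (shift (lam (f⁻ x)) (subst (_< C⁻.rank x) cap fl))
    where
    shift : ∀ l → l ∸ 1 < C⁻.rank x → l < suc (C⁻.rank x)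
    shift zero    _   = s≤s z≤n
    shift (suc l) l<r = s≤s l<r

  row-suc : ∀ x → C.row (Fin.suc x) ≡ C⁻.row x
  row-suc x with position x
  ... | inj₁ (cap , rk) = cong suc (cong₂ _∸_ (sym cap) rk)
  ... | inj₂ (cap , rk) = cong suc (trans (cong (lam (f⁻ x) ∸_) rk)
                            (trans (sym (NP.∸-+-assoc (lam (f⁻ x)) 1 (C⁻.rank x))) (cong (_∸ C⁻.rank x) (sym cap))))

  coinv-suc→ : ∀ x y → C.Coinv (Fin.suc x) (Fin.suc y) → C⁻.Coinv x y
  coinv-suc→ x y (inj₁ (fl , s≤s x<y , b<b , nfl , r)) =
    inj₁ (floating-suc→ x fl , x<y , b<b , nfl ∘ floating-suc← y , trans (sym (row-suc y)) r)
  coinv-suc→ x y (inj₂ (inj₁ (nflx , s≤s x<y , b<b , nfl , r))) =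
    inj₂ (inj₁ (nflx ∘ floating-suc← x , x<y , b<b , nfl ∘ floating-suc← y , trans (sym (row-suc y)) (trans r (row-suc x))))
  coinv-suc→ x y (inj₂ (inj₂ (nflx , s≤s x<y , b<b , nfl , r))) =
    inj₂ (inj₂ (nflx ∘ floating-suc← x , x<y , b<b , nfl ∘ floating-suc← y , trans (sym (row-suc y)) (trans r (cong suc (row-suc x)))))

  coinv-suc← : ∀ x y → C⁻.Coinv x y → C.Coinv (Fin.suc x) (Fin.suc y)
  coinv-suc← x y (inj₁ (fl , x<y , b<b , nfl , r)) =
    inj₁ (floating-suc← x fl , s≤s x<y , b<b , nfl ∘ floating-suc→ y , trans (row-suc y) r)
  coinv-suc← x y (inj₂ (inj₁ (nflx , x<y , b<b , nfl , r))) =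
    inj₂ (inj₁ (nflx ∘ floating-suc→ x , s≤s x<y , b<b , nfl ∘ floating-suc→ y , trans (row-suc y) (trans r (sym (row-suc x)))))
  coinv-suc← x y (inj₂ (inj₂ (nflx , x<y , b<b , nfl , r))) =
    inj₂ (inj₂ (nflx ∘ floating-suc→ x , s≤s x<y , b<b , nfl ∘ floating-suc→ y , trans (row-suc y) (trans r (cong suc (sym (row-suc x))))))

  -- a coinversion (x, y) always has x < y
  no-coinv-into-zero : ∀ x → ¬ C.Coinv x Fin.zero
  no-coinv-into-zero x (inj₁ (_ , () , _))
  no-coinv-into-zero x (inj₂ (inj₁ (_ , () , _)))
  no-coinv-into-zero x (inj₂ (inj₂ (_ , () , _)))

  codeAt-suc : ∀ x → C.codeAt (Fin.suc x) ≡ C⁻.codeAt x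
  codeAt-suc x = cong₂ _+_ coinversions floatingPart
    where
    coinversions : count (C.coinv? (Fin.suc x)) ≡ count (C⁻.coinv? x)
    coinversions = begin
      count (C.coinv? (Fin.suc x))
        ≡⟨ count≡∑ (C.coinv? (Fin.suc x)) ⟩
      χ (C.coinv? (Fin.suc x) Fin.zero) + ∑ n (λ y → χ (C.coinv? (Fin.suc x) (Fin.suc y)))
        ≡⟨ cong₂ _+_ (χ-no (no-coinv-into-zero (Fin.suc x)) _)
                     (∑-cong n (λ y → χ-cong (coinv-suc→ x y) (coinv-suc← x y) _ _)) ⟩
      ∑ n (χ ∘ C⁻.coinv? x)
        ≡⟨ count≡∑ (C⁻.coinv? x) ⟨
      count (C⁻.coinv? x) ∎
      where open ≡-Reasoning
    floatingPart : (if ⌊ C.floating? (Fin.suc x) ⌋ then toℕ (f⁻ x) else 0) ≡ (if ⌊ C⁻.floating? x ⌋ then toℕ (f⁻ x) else 0)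
    floatingPart = cong (λ b → if b then toℕ (f⁻ x) else 0) (⌊⌋-cong (floating-suc→ x) (floating-suc← x) _ _)

  code-suc : code lam f ≡ C.codeAt Fin.zero ∷ code lam⁻ f⁻
  code-suc = cong (C.codeAt Fin.zero ∷_) (begin
    map C.codeAt (tabulate Fin.suc)      ≡⟨ map-tabulate Fin.suc C.codeAt ⟩
    tabulate (C.codeAt ∘ Fin.suc)        ≡⟨ tabulate-cong codeAt-suc ⟩
    tabulate C⁻.codeAt                   ≡⟨ map-tabulate (λ x → x) C⁻.codeAt ⟨
    map C⁻.codeAt (allFin n)             ∎)
    where open ≡-Reasoning

  blockSize-suc : ∀ q → BlockSize f q ≡ χ (p Fin.≟ q) + BlockSize f⁻ q
  blockSize-suc q = trans (count≡∑ (λ x → f x Fin.≟ q)) (cong (χ (p Fin.≟ q) +_) (sym (count≡∑ (λ x → f⁻ x Fin.≟ q))))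

  inOP-remove : InOP (suc n) s lam f → InOP n s lam⁻ f⁻
  inOP-remove op q = cases (q Fin.≟ p)
    where
    cases : Dec (q ≡ p) → lam⁻ q ≤ BlockSize f⁻ q
    cases (yes refl) = subst (_≤ BlockSize f⁻ q) (sym (lowerPart-here lam q))
      (≤suc⇒∸1≤ (lam q) (subst (lam q ≤_) (trans (blockSize-suc q) (cong (_+ BlockSize f⁻ q) (χ-yes refl (p Fin.≟ q)))) (op q)))
    cases (no q≢p) = subst (_≤ BlockSize f⁻ q) (sym (lowerPart-else lam p q q≢p))
      (subst (lam q ≤_) (trans (blockSize-suc q) (cong (_+ BlockSize f⁻ q) (χ-no (q≢p ∘ sym) (p Fin.≟ q)))) (op q))

  inOP-insert : InOP n s lam⁻ f⁻ → InOP (suc n) s lam f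
  inOP-insert op q = cases (q Fin.≟ p)
    where
    cases : Dec (q ≡ p) → lam q ≤ BlockSize f q
    cases (yes refl) = subst (lam q ≤_) (sym (trans (blockSize-suc q) (cong (_+ BlockSize f⁻ q) (χ-yes refl (p Fin.≟ q)))))
      (∸1≤⇒≤suc (lam q) (subst (_≤ BlockSize f⁻ q) (lowerPart-here lam q) (op q)))
    cases (no q≢p) = subst (lam q ≤_) (sym (trans (blockSize-suc q) (cong (_+ BlockSize f⁻ q) (χ-no (q≢p ∘ sym) (p Fin.≟ q)))))
      (subst (_≤ BlockSize f⁻ q) (lowerPart-else lam p q q≢p) (op q))

  floating-zero→ : C.Floating Fin.zero → lam p ≡ 0
  floating-zero→ fl = NP.n≤0⇒n≡0 (NP.≤-pred (subst (lam p <_) rank-zero fl))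

  floating-zero← : lam p ≡ 0 → C.Floating Fin.zero
  floating-zero← e = subst₂ _<_ (sym e) (sym rank-zero) (s≤s z≤n)

  row-zero : C.row Fin.zero ≡ suc (lam p ∸ 1)
  row-zero = cong (λ r → suc (lam p ∸ r)) rank-zero

-- In a diagram of OP_{n,λ} every column q with
-- λ_q ≥ r has exactly one (filled) box in row r, so for any set Q of blocks
-- the number of non-floating elements in row r of a block of Q equals the
-- number of columns q ∈ Q with λ_q ≥ r.  This turns the coinversions of the
-- smallest element into a count of columns.

reaches-split : ∀ l r → 1 ≤ r → χ (r ℕ.≤? l) ≡ χ (l ℕ.≟ r) + χ (r ℕ.≤? l ∸ 1)
reaches-split zero    r 1≤r = trans (χ-no (λ r≤0 → NP.<-irrefl refl (NP.≤-trans 1≤r r≤0)) (r ℕ.≤? 0))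
  (sym (cong₂ _+_ (χ-no (λ 0≡r → NP.<-irrefl 0≡r 1≤r) (0 ℕ.≟ r)) (χ-no (λ r≤0 → NP.<-irrefl refl (NP.≤-trans 1≤r r≤0)) (r ℕ.≤? 0))))
reaches-split (suc l) r 1≤r = trans (χ-cong to from (r ℕ.≤? suc l) ((suc l ℕ.≟ r) ⊎-dec (r ℕ.≤? l)))
  (χ-⊎ (suc l ℕ.≟ r) (r ℕ.≤? l) (λ { (refl , r≤l) → NP.<-irrefl refl r≤l }))
  where
  to : r ≤ suc l → suc l ≡ r ⊎ r ≤ l
  to r≤1+l = [ inj₂ ∘ NP.≤-pred , inj₁ ∘ sym ]′ (NP.m≤n⇒m<n∨m≡n r≤1+l)
  from : suc l ≡ r ⊎ r ≤ l → r ≤ suc l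
  from (inj₁ refl) = NP.≤-refl
  from (inj₂ r≤l)  = NP.m≤n⇒m≤1+n r≤l

module _ {s : ℕ} {Q : Pred (Fin s) Agda.Primitive.lzero} (Q? : Decidable Q) where

  inRow : ∀ n (lam : Fin s → ℕ) (f : Fin n → Fin s) → ℕ → ℕ
  inRow n lam f r = ∑ n (λ y → χ (Q? (f y) ×-dec (¬? (Container.floating? lam f y) ×-dec (Container.row lam f y ℕ.≟ r))))

  columnsReaching : (Fin s → ℕ) → ℕ → ℕ
  columnsReaching lam r = ∑ s (λ q → χ (Q? q ×-dec (r ℕ.≤? lam q)))

  module _ {n : ℕ} (lam : Fin s → ℕ) (f : Fin (suc n) → Fin s) (r : ℕ) where
    open Removal lam f

    -- the bottom box of column p, which sits in row r iff λ_p = r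
    bottomBox : ℕ
    bottomBox = χ (Q? p ×-dec (lam p ℕ.≟ r))

    inRow-remove : 1 ≤ r → inRow (suc n) lam f r ≡ bottomBox + inRow n lam⁻ f⁻ r
    inRow-remove 1≤r = cong₂ _+_
      (χ-cong (λ { (q , nfl , row≡r) → q , nonFloating→ nfl row≡r }) (λ { (q , lp≡r) → q , nonFloating← lp≡r }) _ _)
      (∑-cong n (λ y → χ-cong (λ { (q , nfl , e) → q , nfl ∘ floating-suc← y , trans (sym (row-suc y)) e })
                               (λ { (q , nfl , e) → q , nfl ∘ floating-suc→ y , trans (row-suc y) e }) _ _))
      where
      nonFloating→ : ¬ C.Floating Fin.zero → C.row Fin.zero ≡ r → lam p ≡ r
      nonFloating→ nfl row≡r = trans (sym (suc∸1 (NP.≰⇒> (λ lp≤0 → nfl (floating-zero← (NP.n≤0⇒n≡0 lp≤0)))))) (trans (sym row-zero) row≡r)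
      nonFloating← : lam p ≡ r → ¬ C.Floating Fin.zero × C.row Fin.zero ≡ r
      nonFloating← lp≡r = (λ fl → NP.<-irrefl (trans (sym (floating-zero→ fl)) lp≡r) 1≤r)
                        , trans row-zero (trans (suc∸1 (subst (1 ≤_) (sym lp≡r) 1≤r)) lp≡r)

    columnsReaching-lower : 1 ≤ r → columnsReaching lam r ≡ bottomBox + columnsReaching lam⁻ r
    columnsReaching-lower 1≤r = NP.+-cancelʳ-≡ (h p) _ _ (begin
      ∑ s g + h p                 ≡⟨ ∑-changeOne s g h p (λ q q≢p → cong (λ v → χ (Q? q ×-dec (r ℕ.≤? v))) (sym (lowerPart-else lam p q q≢p))) ⟩
      ∑ s h + g p                 ≡⟨ cong (∑ s h +_) gp ⟩
      ∑ s h + (bottomBox + h p)   ≡⟨ rearrange (∑ s h) bottomBox (h p) ⟩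
      bottomBox + ∑ s h + h p     ∎)
      where
      open ≡-Reasoning
      g h : Fin s → ℕ
      g q = χ (Q? q ×-dec (r ℕ.≤? lam q))
      h q = χ (Q? q ×-dec (r ℕ.≤? lam⁻ q))
      rearrange : ∀ a b c → a + (b + c) ≡ b + a + c
      rearrange = solve-∀
      gp : g p ≡ bottomBox + h p
      gp = begin
        g p                                                           ≡⟨ χ-× (Q? p) (r ℕ.≤? lam p) ⟩
        χ (Q? p) ℕ.* χ (r ℕ.≤? lam p)                                  ≡⟨ cong (χ (Q? p) ℕ.*_) (reaches-split (lam p) r 1≤r) ⟩
        χ (Q? p) ℕ.* (χ (lam p ℕ.≟ r) + χ (r ℕ.≤? lam p ∸ 1))         ≡⟨ NP.*-distribˡ-+ (χ (Q? p)) _ _ ⟩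
        χ (Q? p) ℕ.* χ (lam p ℕ.≟ r) + χ (Q? p) ℕ.* χ (r ℕ.≤? lam p ∸ 1) ≡⟨ cong₂ _+_ (sym (χ-× (Q? p) (lam p ℕ.≟ r))) (sym (χ-× (Q? p) (r ℕ.≤? lam p ∸ 1))) ⟩
        bottomBox + χ (Q? p ×-dec (r ℕ.≤? lam p ∸ 1))                 ≡⟨ cong (bottomBox +_) (χ-cong (λ { (q , le) → q , subst (r ≤_) (sym (lowerPart-here lam p)) le })
                                                                          (λ { (q , le) → q , subst (r ≤_) (lowerPart-here lam p) le }) _ _) ⟩
        bottomBox + h p                                               ∎

  rows≡columns : ∀ n (lam : Fin s → ℕ) (f : Fin n → Fin s) → InOP n s lam f → ∀ r → 1 ≤ r → inRow n lam f r ≡ columnsReaching lam r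
  rows≡columns zero lam f op r 1≤r =
    sym (∑-zero s (λ q → trans (χ-× (Q? q) (r ℕ.≤? lam q))
      (trans (cong (χ (Q? q) ℕ.*_) (χ-no (λ r≤lq → NP.<-irrefl refl (NP.≤-trans 1≤r (NP.≤-trans r≤lq (op q)))) (r ℕ.≤? lam q)))
             (NP.*-zeroʳ (χ (Q? q))))))
  rows≡columns (suc n) lam f op r 1≤r = begin
    inRow (suc n) lam f r                      ≡⟨ inRow-remove lam f r 1≤r ⟩
    bottomBox lam f r + inRow n lam⁻ f⁻ r      ≡⟨ cong (bottomBox lam f r +_) (rows≡columns n lam⁻ f⁻ (inOP-remove op) r 1≤r) ⟩
    bottomBox lam f r + columnsReaching lam⁻ r ≡⟨ columnsReaching-lower lam f r 1≤r ⟨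
    columnsReaching lam r                      ∎
    where
    open ≡-Reasoning
    open Removal lam f

injective⇒surjective : ∀ m (G : Fin m → Fin m) → (∀ i j → G i ≡ G j → i ≡ j) → ∀ a → Σ (Fin m) (λ i → G i ≡ a)
injective⇒surjective zero    G inj ()
injective⇒surjective (suc m) G inj a with FP.any? (λ i → G i Fin.≟ a)
... | yes hit = hit
... | no miss = ⊥-elim (FP.<-irrefl (inj i j (FP.punchOut-injective (avoid i) (avoid j) Gi≡Gj)) i<j)
  where
  avoid : ∀ i → a ≢ G i
  avoid i a≡Gi = miss (i , sym a≡Gi)
  collision = FP.pigeonhole (NP.n<1+n m) (λ i → Fin.punchOut (avoid i))
  i j : Fin (suc m)
  i = proj₁ collision
  j = proj₁ (proj₂ collision)
  i<j = proj₁ (proj₂ (proj₂ collision))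
  Gi≡Gj = proj₂ (proj₂ (proj₂ collision))

-- The order on blocks governing the code entry of the smallest element:
-- q ≺ p if column q is longer than column p, or they have the same length
-- and either they are nonempty and q is to the right of p, or they are
-- empty and q is to the left of p.  This is a strict total order, so the
-- number rank p of blocks before p is a bijection from blocks to [0, s).

module BlockOrder {s : ℕ} (lam : Fin s → ℕ) where

  _≺_ : Fin s → Fin s → Set
  q ≺ p = (lam p < lam q) ⊎ (lam q ≡ lam p × ((1 ≤ lam p × p Fin.< q) ⊎ (lam p ≡ 0 × q Fin.< p)))

  _≺?_ : ∀ q p → Dec (q ≺ p)
  q ≺? p = (lam p ℕ.<? lam q) ⊎-dec ((lam q ℕ.≟ lam p) ×-dec
             (((1 ℕ.≤? lam p) ×-dec (p Fin.<? q)) ⊎-dec ((lam p ℕ.≟ 0) ×-dec (q Fin.<? p))))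

  ≺-irrefl : ∀ p → ¬ p ≺ p
  ≺-irrefl p (inj₁ lt)                  = NP.<-irrefl refl lt
  ≺-irrefl p (inj₂ (_ , inj₁ (_ , lt))) = FP.<-irrefl refl lt
  ≺-irrefl p (inj₂ (_ , inj₂ (_ , lt))) = FP.<-irrefl refl lt

  ≺⇒≥ : ∀ q p → q ≺ p → lam p ≤ lam q
  ≺⇒≥ q p (inj₁ lt)      = NP.<⇒≤ lt
  ≺⇒≥ q p (inj₂ (e , _)) = NP.≤-reflexive (sym e)

  ≺-trans : ∀ a b c → a ≺ b → b ≺ c → a ≺ c
  ≺-trans a b c (inj₁ lt)      b≺c       = inj₁ (NP.≤-<-trans (≺⇒≥ b c b≺c) lt)
  ≺-trans a b c (inj₂ (e , _)) (inj₁ lt) = inj₁ (subst (lam c <_) (sym e) lt)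
  ≺-trans a b c (inj₂ (e₁ , inj₁ (pos , lt₁))) (inj₂ (e₂ , inj₁ (_ , lt₂))) = inj₂ (trans e₁ e₂ , inj₁ (subst (1 ≤_) e₂ pos , FP.<-trans lt₂ lt₁))
  ≺-trans a b c (inj₂ (e₁ , inj₁ (pos , _)))   (inj₂ (e₂ , inj₂ (z , _)))  = ⊥-elim (NP.<-irrefl (sym (trans e₂ z)) pos)
  ≺-trans a b c (inj₂ (e₁ , inj₂ (z , _)))     (inj₂ (e₂ , inj₁ (pos , _))) = ⊥-elim (NP.<-irrefl (sym (trans (sym e₂) z)) pos)
  ≺-trans a b c (inj₂ (e₁ , inj₂ (_ , lt₁)))   (inj₂ (e₂ , inj₂ (z , lt₂))) = inj₂ (trans e₁ e₂ , inj₂ (z , FP.<-trans lt₁ lt₂))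

  ≺-connex : ∀ a b → a ≢ b → a ≺ b ⊎ b ≺ a
  ≺-connex a b a≢b with NP.<-cmp (lam a) (lam b)
  ... | tri< lt _ _ = inj₂ (inj₁ lt)
  ... | tri> _ _ gt = inj₁ (inj₁ gt)
  ... | tri≈ _ e _ with lam b ℕ.≟ 0 | FP.<-cmp a b
  ...   | _        | tri≈ _ a≡b _ = ⊥-elim (a≢b a≡b)
  ...   | yes z    | tri< lt _ _  = inj₁ (inj₂ (e , inj₂ (z , lt)))
  ...   | yes z    | tri> _ _ gt  = inj₂ (inj₂ (sym e , inj₂ (trans e z , gt)))
  ...   | no nz    | tri< lt _ _  = inj₂ (inj₂ (sym e , inj₁ (subst (1 ≤_) (sym e) (NP.n≢0⇒n>0 nz) , lt)))
  ...   | no nz    | tri> _ _ gt  = inj₁ (inj₂ (e , inj₁ (NP.n≢0⇒n>0 nz , gt)))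

  rank : Fin s → ℕ
  rank p = ∑ s (λ q → χ (q ≺? p))

  rank<s : ∀ p → rank p < s
  rank<s p = subst (rank p <_) (∑-ones s)
    (∑-strictMono s (λ q → χ≤1 (q ≺? p)) p (subst (_< 1) (sym (χ-no (≺-irrefl p) (p ≺? p))) (s≤s z≤n)))

  rank-strictMono : ∀ a b → a ≺ b → rank a < rank b
  rank-strictMono a b a≺b = ∑-strictMono s (λ q → χ-mono (λ q≺a → ≺-trans q a b q≺a a≺b) (q ≺? a) (q ≺? b)) a
    (subst₂ _<_ (sym (χ-no (≺-irrefl a) (a ≺? a))) (sym (χ-yes a≺b (a ≺? b))) (s≤s z≤n))

  rank-injective : ∀ a b → rank a ≡ rank b → a ≡ b
  rank-injective a b e with a Fin.≟ b
  ... | yes a≡b = a≡b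
  ... | no a≢b with ≺-connex a b a≢b
  ...   | inj₁ a≺b = ⊥-elim (NP.<-irrefl e (rank-strictMono a b a≺b))
  ...   | inj₂ b≺a = ⊥-elim (NP.<-irrefl (sym e) (rank-strictMono b a b≺a))

  rank-surjective : ∀ a → a < s → Σ (Fin s) (λ p → rank p ≡ a)
  rank-surjective a a<s with injective⇒surjective s rankFin rankFin-injective (Fin.fromℕ< a<s)
    where
    rankFin : Fin s → Fin s
    rankFin p = Fin.fromℕ< (rank<s p)
    rankFin-injective : ∀ i j → rankFin i ≡ rankFin j → i ≡ j
    rankFin-injective i j e = rank-injective i j
      (trans (sym (FP.toℕ-fromℕ< (rank<s i))) (trans (cong toℕ e) (FP.toℕ-fromℕ< (rank<s j))))
  ... | p , e = p , trans (sym (FP.toℕ-fromℕ< (rank<s p))) (trans (cong toℕ e) (FP.toℕ-fromℕ< a<s))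

  conj≡∑ : ∀ j → conj lam j ≡ ∑ s (λ q → χ (j ℕ.≤? lam q))
  conj≡∑ j = count≡∑ (λ q → j ℕ.≤? lam q)

  conj-antitone : ∀ {j j'} → j ≤ j' → conj lam j' ≤ conj lam j
  conj-antitone {j} {j'} j≤j' = subst₂ _≤_ (sym (conj≡∑ j')) (sym (conj≡∑ j))
    (∑-mono s (λ q → χ-mono (NP.≤-trans j≤j') (j' ℕ.≤? lam q) (j ℕ.≤? lam q)))

  conj≤s : ∀ j → conj lam j ≤ s
  conj≤s j = subst₂ _≤_ (sym (conj≡∑ j)) (∑-ones s) (∑-mono s (λ q → χ≤1 (j ℕ.≤? lam q)))

  rank<conj : ∀ p → rank p < conj lam (lam p)
  rank<conj p = subst (rank p <_) (sym (conj≡∑ (lam p)))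
    (∑-strictMono s (λ q → χ-mono (≺⇒≥ q p) (q ≺? p) (lam p ℕ.≤? lam q)) p
      (subst₂ _<_ (sym (χ-no (≺-irrefl p) (p ≺? p))) (sym (χ-yes NP.≤-refl (lam p ℕ.≤? lam p))) (s≤s z≤n)))

  conj-suc≤rank : ∀ p → conj lam (suc (lam p)) ≤ rank p
  conj-suc≤rank p = subst (_≤ rank p) (sym (conj≡∑ (suc (lam p))))
    (∑-mono s (λ q → χ-mono inj₁ (suc (lam p) ℕ.≤? lam q) (q ≺? p)))

  emptyColumn-rank : ∀ p → lam p ≡ 0 → conj lam 1 ≤ rank p
  emptyColumn-rank p e = subst (_≤ rank p) (sym (conj≡∑ 1))
    (∑-mono s (λ q → χ-mono (λ 1≤lq → inj₁ (subst (_< lam q) (sym e) 1≤lq)) (1 ℕ.≤? lam q) (q ≺? p)))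

-- The code entry of the smallest element is the rank of its block p.  If
-- column p is empty, 0 floats: it contributes p - 1 (the blocks to its left)
-- plus one coinversion for each top-row box to the right of p.  Otherwise 0
-- sits in the bottom box of column p, in row λ_p, and its coinversions are
-- the boxes in row λ_p to the right and in row λ_p + 1 to the left.  In both
-- cases rows≡columns turns these into counts of columns, which are exactly
-- the blocks preceding p in the block order.

module Head {n s : ℕ} (lam : Fin s → ℕ) (f : Fin (suc n) → Fin s) (op : InOP (suc n) s lam f) where
  open Removal lam f
  open BlockOrder lam

  right? : ∀ (q : Fin s) → Dec (p Fin.< q)
  right? q = p Fin.<? q

  left? : ∀ (q : Fin s) → Dec (q Fin.< p)
  left? q = q Fin.<? p

  after-zero : ∀ y → f y ≢ p → Fin.zero {n} Fin.< y
  after-zero Fin.zero    fy≢p = ⊥-elim (fy≢p refl)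
  after-zero (Fin.suc y) _    = s≤s z≤n

  precedingLeft precedingRight : ℕ
  precedingLeft  = ∑ s (λ q → χ (q ≺? p ×-dec left? q))
  precedingRight = ∑ s (λ q → χ (q ≺? p ×-dec ¬? (left? q)))

  rank-bySide : rank p ≡ precedingLeft + precedingRight
  rank-bySide = ∑-split s (_≺? p) left?

  ≺-right : ∀ q → q ≺ p → ¬ q Fin.< p → p Fin.< q
  ≺-right q q≺p q≮p with FP.<-cmp q p
  ... | tri< q<p _ _ = ⊥-elim (q≮p q<p)
  ... | tri≈ _ refl _ = ⊥-elim (≺-irrefl q q≺p)
  ... | tri> _ _ p<q = p<q

  floatingPart : ℕ
  floatingPart = if ⌊ C.floating? Fin.zero ⌋ then toℕ p else 0

  module EmptyColumn (lp≡0 : lam p ≡ 0) where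

    fl : C.Floating Fin.zero
    fl = floating-zero← lp≡0

    -- only coinversions of type (a): top-row boxes to the right
    coinversions : count (C.coinv? Fin.zero) ≡ columnsReaching right? lam 1
    coinversions = trans (count≡∑ (C.coinv? Fin.zero))
      (trans (∑-cong (suc n) (λ y → χ-cong
          (λ { (inj₁ (_ , _ , p<fy , nfl , r)) → p<fy , nfl , r
             ; (inj₂ (inj₁ (nfl0 , _))) → ⊥-elim (nfl0 fl)
             ; (inj₂ (inj₂ (nfl0 , _))) → ⊥-elim (nfl0 fl) })
          (λ { (p<fy , nfl , r) → inj₁ (fl , after-zero y (FP.<⇒≢ p<fy ∘ sym) , p<fy , nfl , r) })
          (C.coinv? Fin.zero y) (right? (f y) ×-dec (¬? (C.floating? y) ×-dec (C.row y ℕ.≟ 1)))))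
        (rows≡columns right? (suc n) lam f op 1 (s≤s z≤n)))

    -- every block to the left precedes p: it is longer, or empty and to the left
    leftBlocks : precedingLeft ≡ toℕ p
    leftBlocks = trans (∑-cong s (λ q → χ-cong proj₂ (λ q<p → precedes q q<p , q<p) (q ≺? p ×-dec left? q) (left? q))) (∑-below s p)
      where
      precedes : ∀ q → q Fin.< p → q ≺ p
      precedes q q<p with lam q ℕ.≟ 0
      ... | yes lq≡0 = inj₂ (trans lq≡0 (sym lp≡0) , inj₂ (lp≡0 , q<p))
      ... | no lq≢0  = inj₁ (subst (_< lam q) (sym lp≡0) (NP.n≢0⇒n>0 lq≢0))

    rightBlocks : precedingRight ≡ columnsReaching right? lam 1
    rightBlocks = ∑-cong s (λ q → χ-cong
      (λ { (q≺p , q≮p) → ≺-right q q≺p q≮p , subst (_< lam q) lp≡0 (longer q q≺p q≮p) })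
      (λ { (p<q , 1≤lq) → inj₁ (subst (_< lam q) (sym lp≡0) 1≤lq) , FP.<-asym p<q })
      (q ≺? p ×-dec ¬? (left? q)) (right? q ×-dec (1 ℕ.≤? lam q)))
      where
      longer : ∀ q → q ≺ p → ¬ q Fin.< p → lam p < lam q
      longer q (inj₁ lt)                   _   = lt
      longer q (inj₂ (_ , inj₁ (pos , _))) _   = ⊥-elim (NP.<-irrefl (sym lp≡0) pos)
      longer q (inj₂ (_ , inj₂ (_ , q<p))) q≮p = ⊥-elim (q≮p q<p)

    codeAt-zero-empty : C.codeAt Fin.zero ≡ rank p
    codeAt-zero-empty = begin
      count (C.coinv? Fin.zero) + floatingPart
        ≡⟨ cong₂ _+_ coinversions (cong (λ b → if b then toℕ p else 0) (⌊⌋-yes fl (C.floating? Fin.zero))) ⟩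
      columnsReaching right? lam 1 + toℕ p
        ≡⟨ NP.+-comm _ (toℕ p) ⟩
      toℕ p + columnsReaching right? lam 1
        ≡⟨ cong₂ _+_ leftBlocks rightBlocks ⟨
      precedingLeft + precedingRight
        ≡⟨ rank-bySide ⟨
      rank p ∎
      where open ≡-Reasoning

  module NonemptyColumn (l : ℕ) (lp≡1+l : lam p ≡ suc l) where

    nfl : ¬ C.Floating Fin.zero
    nfl fl = NP.<-irrefl (sym (trans (sym lp≡1+l) (floating-zero→ fl))) (s≤s z≤n)

    row0 : C.row Fin.zero ≡ suc l
    row0 = trans row-zero (cong (λ x → suc (x ∸ 1)) lp≡1+l)

    SameRowRight RowBelowLeft : Fin (suc n) → Set
    SameRowRight y = p Fin.< f y × ¬ C.Floating y × C.row y ≡ suc l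
    RowBelowLeft y = f y Fin.< p × ¬ C.Floating y × C.row y ≡ suc (suc l)

    sameRowRight? : ∀ y → Dec (SameRowRight y)
    sameRowRight? y = right? (f y) ×-dec (¬? (C.floating? y) ×-dec (C.row y ℕ.≟ suc l))

    rowBelowLeft? : ∀ y → Dec (RowBelowLeft y)
    rowBelowLeft? y = left? (f y) ×-dec (¬? (C.floating? y) ×-dec (C.row y ℕ.≟ suc (suc l)))

    coinv→ : ∀ y → C.Coinv Fin.zero y → SameRowRight y ⊎ RowBelowLeft y
    coinv→ y (inj₁ (fl , _))                          = ⊥-elim (nfl fl)
    coinv→ y (inj₂ (inj₁ (_ , _ , p<fy , nfly , r))) = inj₁ (p<fy , nfly , trans r row0)
    coinv→ y (inj₂ (inj₂ (_ , _ , fy<p , nfly , r))) = inj₂ (fy<p , nfly , trans r (cong suc row0))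

    coinv← : ∀ y → SameRowRight y ⊎ RowBelowLeft y → C.Coinv Fin.zero y
    coinv← y (inj₁ (p<fy , nfly , r)) = inj₂ (inj₁ (nfl , after-zero y (FP.<⇒≢ p<fy ∘ sym) , p<fy , nfly , trans r (sym row0)))
    coinv← y (inj₂ (fy<p , nfly , r)) = inj₂ (inj₂ (nfl , after-zero y (FP.<⇒≢ fy<p) , fy<p , nfly , trans r (cong suc (sym row0))))

    coinversions : count (C.coinv? Fin.zero) ≡ columnsReaching right? lam (suc l) + columnsReaching left? lam (suc (suc l))
    coinversions = begin
      count (C.coinv? Fin.zero)
        ≡⟨ count≡∑ (C.coinv? Fin.zero) ⟩
      ∑ (suc n) (χ ∘ C.coinv? Fin.zero)
        ≡⟨ ∑-cong (suc n) (λ y → trans (χ-cong (coinv→ y) (coinv← y) (C.coinv? Fin.zero y) (sameRowRight? y ⊎-dec rowBelowLeft? y))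
                                        (χ-⊎ (sameRowRight? y) (rowBelowLeft? y) (λ { ((p<fy , _) , (fy<p , _)) → FP.<-asym p<fy fy<p }))) ⟩
      ∑ (suc n) (λ y → χ (sameRowRight? y) + χ (rowBelowLeft? y))
        ≡⟨ ∑-+ (suc n) (χ ∘ sameRowRight?) (χ ∘ rowBelowLeft?) ⟩
      inRow right? (suc n) lam f (suc l) + inRow left? (suc n) lam f (suc (suc l))
        ≡⟨ cong₂ _+_ (rows≡columns right? (suc n) lam f op (suc l) (s≤s z≤n)) (rows≡columns left? (suc n) lam f op (suc (suc l)) (s≤s z≤n)) ⟩
      columnsReaching right? lam (suc l) + columnsReaching left? lam (suc (suc l)) ∎
      where open ≡-Reasoning

    leftBlocks : precedingLeft ≡ columnsReaching left? lam (suc (suc l))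
    leftBlocks = ∑-cong s (λ q → χ-cong
      (λ { (q≺p , q<p) → q<p , subst (_< lam q) lp≡1+l (longer q q≺p q<p) })
      (λ { (q<p , 2+l≤lq) → inj₁ (subst (_< lam q) (sym lp≡1+l) 2+l≤lq) , q<p })
      (q ≺? p ×-dec left? q) (left? q ×-dec (suc (suc l) ℕ.≤? lam q)))
      where
      longer : ∀ q → q ≺ p → q Fin.< p → lam p < lam q
      longer q (inj₁ lt)                   _   = lt
      longer q (inj₂ (_ , inj₁ (_ , p<q))) q<p = ⊥-elim (FP.<-asym p<q q<p)
      longer q (inj₂ (_ , inj₂ (z , _)))   _   = ⊥-elim (NP.<-irrefl (sym (trans (sym lp≡1+l) z)) (s≤s z≤n))

    rightBlocks : precedingRight ≡ columnsReaching right? lam (suc l)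
    rightBlocks = ∑-cong s (λ q → χ-cong
      (λ { (q≺p , q≮p) → ≺-right q q≺p q≮p , subst (_≤ lam q) lp≡1+l (≺⇒≥ q p q≺p) })
      (λ { (p<q , 1+l≤lq) → precedes q p<q 1+l≤lq , FP.<-asym p<q })
      (q ≺? p ×-dec ¬? (left? q)) (right? q ×-dec (suc l ℕ.≤? lam q)))
      where
      precedes : ∀ q → p Fin.< q → suc l ≤ lam q → q ≺ p
      precedes q p<q 1+l≤lq with NP.m≤n⇒m<n∨m≡n (subst (_≤ lam q) (sym lp≡1+l) 1+l≤lq)
      ... | inj₁ lp<lq = inj₁ lp<lq
      ... | inj₂ lp≡lq = inj₂ (sym lp≡lq , inj₁ (subst (1 ≤_) (sym lp≡1+l) (s≤s z≤n) , p<q))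

    codeAt-zero-nonempty : C.codeAt Fin.zero ≡ rank p
    codeAt-zero-nonempty = begin
      count (C.coinv? Fin.zero) + floatingPart
        ≡⟨ cong₂ _+_ coinversions (cong (λ b → if b then toℕ p else 0) (⌊⌋-no nfl (C.floating? Fin.zero))) ⟩
      columnsReaching right? lam (suc l) + columnsReaching left? lam (suc (suc l)) + 0
        ≡⟨ NP.+-identityʳ _ ⟩
      columnsReaching right? lam (suc l) + columnsReaching left? lam (suc (suc l))
        ≡⟨ NP.+-comm (columnsReaching right? lam (suc l)) _ ⟩
      columnsReaching left? lam (suc (suc l)) + columnsReaching right? lam (suc l)
        ≡⟨ cong₂ _+_ leftBlocks rightBlocks ⟨
      precedingLeft + precedingRight
        ≡⟨ rank-bySide ⟨
      rank p ∎
      where open ≡-Reasoning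

  codeAt-zero : C.codeAt Fin.zero ≡ rank p
  codeAt-zero = byLength (lam p) refl
    where
    byLength : ∀ v → lam p ≡ v → C.codeAt Fin.zero ≡ rank p
    byLength zero    lp≡0   = EmptyColumn.codeAt-zero-empty lp≡0
    byLength (suc l) lp≡1+l = NonemptyColumn.codeAt-zero-nonempty l lp≡1+l

-- The staircases of the code set: the j-th one (counting from 0) has the
-- length λ'_{j+1} of row j+1 of the container diagram.
rowLength : ∀ {s} → (Fin s → ℕ) → Heights
rowLength lam j = conj lam (suc j)

module LowerColumn {s : ℕ} (lam : Fin s → ℕ) (p : Fin s) where

  lam⁻ : Fin s → ℕ
  lam⁻ = lowerPart lam p

  lower-empty : lam p ≡ 0 → ∀ q → lam⁻ q ≡ lam q
  lower-empty lp≡0 q = cases (q Fin.≟ p)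
    where
    cases : Dec (q ≡ p) → lam⁻ q ≡ lam q
    cases (yes q≡p) = trans (lowerPart-at lam p q q≡p) (trans (cong (λ v → lam v ∸ 1) q≡p) (trans (cong (_∸ 1) lp≡0) (sym (trans (cong lam q≡p) lp≡0))))
    cases (no q≢p)  = lowerPart-else lam p q q≢p

  rowLength-empty : lam p ≡ 0 → ∀ j → rowLength lam⁻ j ≡ rowLength lam j
  rowLength-empty lp≡0 j = trans (count≡∑ (λ q → suc j ℕ.≤? lam⁻ q))
    (trans (∑-cong s (λ q → cong (λ v → χ (suc j ℕ.≤? v)) (lower-empty lp≡0 q))) (sym (count≡∑ (λ q → suc j ℕ.≤? lam q))))

  size-empty : lam p ≡ 0 → ∑ s lam⁻ ≡ ∑ s lam
  size-empty lp≡0 = ∑-cong s (lower-empty lp≡0)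

  module Nonempty (l : ℕ) (lp≡1+l : lam p ≡ suc l) where

    lam⁻p≡l : lam⁻ p ≡ l
    lam⁻p≡l = trans (lowerPart-here lam p) (cong (_∸ 1) lp≡1+l)

    size-nonempty : ∑ s lam ≡ suc (∑ s lam⁻)
    size-nonempty = NP.+-cancelʳ-≡ l _ _ (begin
      ∑ s lam + l            ≡⟨ cong (∑ s lam +_) (sym lam⁻p≡l) ⟩
      ∑ s lam + lam⁻ p       ≡⟨ ∑-changeOne s lam lam⁻ p (λ q q≢p → sym (lowerPart-else lam p q q≢p)) ⟩
      ∑ s lam⁻ + lam p       ≡⟨ cong (∑ s lam⁻ +_) lp≡1+l ⟩
      ∑ s lam⁻ + suc l       ≡⟨ NP.+-suc (∑ s lam⁻) l ⟩
      suc (∑ s lam⁻) + l     ∎)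
      where open ≡-Reasoning

    module _ (i : ℕ) where
      reaches reaches⁻ : Fin s → ℕ
      reaches  q = χ (suc i ℕ.≤? lam q)
      reaches⁻ q = χ (suc i ℕ.≤? lam⁻ q)

      rowLength≡∑ : rowLength lam i ≡ ∑ s reaches
      rowLength≡∑ = count≡∑ (λ q → suc i ℕ.≤? lam q)

      rowLength⁻≡∑ : rowLength lam⁻ i ≡ ∑ s reaches⁻
      rowLength⁻≡∑ = count≡∑ (λ q → suc i ℕ.≤? lam⁻ q)

      changedAtP : ∑ s reaches + reaches⁻ p ≡ ∑ s reaches⁻ + reaches p
      changedAtP = ∑-changeOne s reaches reaches⁻ p (λ q q≢p → cong (λ v → χ (suc i ℕ.≤? v)) (sym (lowerPart-else lam p q q≢p)))

    rowLength-removed : rowLength lam⁻ l ≡ rowLength lam l ∸ 1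
    rowLength-removed = begin
      rowLength lam⁻ l                ≡⟨ rowLength⁻≡∑ l ⟩
      ∑ s (reaches⁻ l)                ≡⟨ cong (_∸ 1) (trans longer (NP.+-comm (∑ s (reaches⁻ l)) 1)) ⟨
      ∑ s (reaches l) ∸ 1             ≡⟨ cong (_∸ 1) (rowLength≡∑ l) ⟨
      rowLength lam l ∸ 1             ∎
      where
      open ≡-Reasoning
      longer : ∑ s (reaches l) ≡ ∑ s (reaches⁻ l) + 1
      longer = begin
        ∑ s (reaches l)                       ≡⟨ NP.+-identityʳ _ ⟨
        ∑ s (reaches l) + 0                   ≡⟨ cong (∑ s (reaches l) +_) (χ-no (λ le → NP.<-irrefl refl (subst (suc l ≤_) lam⁻p≡l le)) (suc l ℕ.≤? lam⁻ p)) ⟨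
        ∑ s (reaches l) + reaches⁻ l p        ≡⟨ changedAtP l ⟩
        ∑ s (reaches⁻ l) + reaches l p        ≡⟨ cong (∑ s (reaches⁻ l) +_) (χ-yes (NP.≤-reflexive (sym lp≡1+l)) (suc l ℕ.≤? lam p)) ⟩
        ∑ s (reaches⁻ l) + 1                  ∎

    rowLength-other : ∀ i → i ≢ l → rowLength lam⁻ i ≡ rowLength lam i
    rowLength-other i i≢l = trans (rowLength⁻≡∑ i)
      (trans (sym (NP.+-cancelʳ-≡ (reaches⁻ i p) _ _ (trans (changedAtP i) (cong (∑ s (reaches⁻ i) +_) same))))
             (sym (rowLength≡∑ i)))
      where
      same : reaches i p ≡ reaches⁻ i p
      same = χ-cong (λ le → subst (suc i ≤_) (sym lam⁻p≡l) (NP.≤-pred (NP.≤∧≢⇒< (subst (suc i ≤_) lp≡1+l le) (i≢l ∘ NP.suc-injective))))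
                    (λ le → NP.≤-trans (subst (suc i ≤_) lam⁻p≡l le) (subst (l ≤_) (sym lp≡1+l) (NP.n≤1+n l)))
                    (suc i ℕ.≤? lam p) (suc i ℕ.≤? lam⁻ p)

    rowLength-nonempty : ∀ i → rowLength lam⁻ i ≡ lower (rowLength lam) l i
    rowLength-nonempty i = cases (i ℕ.≟ l)
      where
      cases : Dec (i ≡ l) → rowLength lam⁻ i ≡ lower (rowLength lam) l i
      cases (yes refl) = trans rowLength-removed (sym (lower-here (rowLength lam) i))
      cases (no i≢l)   = trans (rowLength-other i i≢l) (sym (lower-else (rowLength lam) l i i≢l))

module _ {s : ℕ} (lam : Fin s → ℕ) where

  emptyPartition-rowLength : (∀ q → lam q ≡ 0) → ∀ j → rowLength lam j ≡ 0
  emptyPartition-rowLength allZero j = trans (BlockOrder.conj≡∑ lam (suc j))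
    (∑-zero s (λ q → χ-no (λ 1+j≤lq → NP.n≮0 (subst (suc j ≤_) (allZero q) 1+j≤lq)) (suc j ℕ.≤? lam q)))

  firstRow-empty : rowLength lam 0 ≡ 0 → ∀ q → lam q ≡ 0
  firstRow-empty row≡0 q = NP.n≤0⇒n≡0 (≮1 (lam q) (subst (χ (1 ℕ.≤? lam q) ≤_) row≡0' (∑-term≤ s _ q)))
    where
    row≡0' : ∑ s (λ q → χ (1 ℕ.≤? lam q)) ≡ 0
    row≡0' = trans (sym (BlockOrder.conj≡∑ lam 1)) row≡0
    ≮1 : ∀ v → χ (1 ℕ.≤? v) ≤ 0 → v ≤ 0
    ≮1 zero    _  = z≤n
    ≮1 (suc v) ()

  sizeZero-empty : ∀ m → ∑ s lam + m ≡ 0 → ∀ q → lam q ≡ 0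
  sizeZero-empty m e q = NP.n≤0⇒n≡0 (NP.≤-trans (∑-term≤ s lam q) (NP.≤-trans (NP.m≤m+n _ m) (NP.≤-reflexive e)))

-- The invariant relating a partition λ to the code set is
-- |λ| + m = n, where m counts the constant entries s - 1 still available.

module _ {s : ℕ} where

  size≤n : ∀ n (lam : Fin s → ℕ) (f : Fin n → Fin s) → InOP n s lam f → ∑ s lam ≤ n
  size≤n zero    lam f op = NP.≤-reflexive (∑-zero s (λ q → NP.n≤0⇒n≡0 (op q)))
  size≤n (suc n) lam f op = byLength (lam p) refl
    where
    open Removal lam f
    module L = LowerColumn lam p
    byLength : ∀ v → lam p ≡ v → ∑ s lam ≤ suc n
    byLength zero    lp≡0   = NP.m≤n⇒m≤1+n (subst (_≤ n) (L.size-empty lp≡0) (size≤n n lam⁻ f⁻ (inOP-remove op)))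
    byLength (suc l) lp≡1+l = subst (_≤ suc n) (sym (L.Nonempty.size-nonempty l lp≡1+l)) (s≤s (size≤n n lam⁻ f⁻ (inOP-remove op)))

  -- Its
  -- first entry is the rank of the block p of the smallest element: a
  -- constant entry if column p is empty, and otherwise an entry of the
  -- staircase of row λ_p, which is exactly the row that loses a box.
  code-fits : ∀ n (lam : Fin s → ℕ) m (f : Fin n → Fin s) → InOP n s lam f → ∑ s lam + m ≡ n →
              Fits s (rowLength lam) m (code lam f)
  code-fits zero lam m f op e =
    subst (λ m → Fits s (rowLength lam) m []) (sym m≡0) (done (emptyPartition-rowLength lam (sizeZero-empty lam m e)))
    where
    m≡0 : m ≡ 0
    m≡0 = NP.n≤0⇒n≡0 (NP.≤-trans (NP.m≤n+m m _) (NP.≤-reflexive e))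
  code-fits (suc n) lam m f op e =
    subst (Fits s (rowLength lam) m) (sym (trans code-suc (cong (_∷ code lam⁻ f⁻) H.codeAt-zero))) (byLength (lam p) refl)
    where
    open Removal lam f
    open BlockOrder lam
    module L = LowerColumn lam p
    module H = Head lam f op
    op⁻ = inOP-remove op
    byLength : ∀ v → lam p ≡ v → Fits s (rowLength lam) m (rank p ∷ code lam⁻ f⁻)
    byLength zero lp≡0 = oneConstantLeft m refl
      where
      -- the removed element floated, so it used up a constant entry
      oneConstantLeft : ∀ m' → m ≡ m' → Fits s (rowLength lam) m (rank p ∷ code lam⁻ f⁻)
      oneConstantLeft zero refl = ⊥-elim (NP.<-irrefl refl (NP.≤-trans (s≤s (subst (_≤ n) (L.size-empty lp≡0) (size≤n n lam⁻ f⁻ op⁻)))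
                                                          (NP.≤-reflexive (sym (trans (sym (NP.+-identityʳ _)) e)))))
      oneConstantLeft (suc m') refl = const (<⇒≤∸1 (rank<s p))
        (fits-ext (code-fits n lam⁻ m' f⁻ op⁻ (NP.suc-injective (trans (cong suc (cong (_+ m') (L.size-empty lp≡0))) (trans (sym (NP.+-suc _ m')) e))))
                  (rowLength lam) (λ j → sym (L.rowLength-empty lp≡0 j)))
    byLength (suc l) lp≡1+l = stair l (subst (rank p <_) (cong (conj lam) lp≡1+l) (rank<conj p))
      (fits-ext (code-fits n lam⁻ m f⁻ op⁻ (NP.suc-injective (trans (cong (_+ m) (sym (L.Nonempty.size-nonempty l lp≡1+l))) e)))
                (lower (rowLength lam) l) (λ i → sym (L.Nonempty.rowLength-nonempty l lp≡1+l i)))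

  -- Injectivity: equal first entries force equal blocks of the smallest
  -- element (rank is injective), and the rest follows by induction.
  code-injective : ∀ n (lam : Fin s → ℕ) (f g : Fin n → Fin s) → InOP n s lam f → InOP n s lam g →
                   code lam f ≡ code lam g → ∀ x → f x ≡ g x
  code-injective zero    lam f g opf opg e ()
  code-injective (suc n) lam f g opf opg e = pointwise
    where
    module F = Removal lam f
    module G = Removal lam g
    codes = ∷-injective (trans (sym F.code-suc) (trans e G.code-suc))
    first : f Fin.zero ≡ g Fin.zero
    first = BlockOrder.rank-injective lam _ _ (trans (sym (Head.codeAt-zero lam f opf)) (trans (proj₁ codes) (Head.codeAt-zero lam g opg)))
    lam⁻ = lowerPart lam (g Fin.zero)
    rest : code lam⁻ F.f⁻ ≡ code lam⁻ G.f⁻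
    rest = subst (λ q → code (lowerPart lam q) F.f⁻ ≡ code lam⁻ G.f⁻) first (proj₂ codes)
    opf⁻ : InOP n s lam⁻ F.f⁻
    opf⁻ = subst (λ q → InOP n s (lowerPart lam q) F.f⁻) first (F.inOP-remove opf)
    pointwise : ∀ x → f x ≡ g x
    pointwise Fin.zero    = first
    pointwise (Fin.suc x) = code-injective n lam⁻ F.f⁻ G.f⁻ opf⁻ (G.inOP-remove opg) rest x

  firstEntry<s : ∀ {lam : Fin s → ℕ} {m a c} → 1 ≤ s → Fits s (rowLength lam) m (a ∷ c) → a < s
  firstEntry<s {lam} _ (stair j a<row _) = NP.<-≤-trans a<row (BlockOrder.conj≤s lam (suc j))
  firstEntry<s 1≤s (const a≤s-1 _) = NP.≤-<-trans a≤s-1 (NP.∸-monoʳ-< {o = 0} (s≤s z≤n) 1≤s)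

  -- Reading off the first entry a = rank p of a fitting code leaves a code
  -- fitting the staircases of λ with the bottom box of column p removed.  If
  -- the column is empty, a precedes every staircase entry, so it was a
  -- constant entry.  Otherwise the staircase of row λ_p is the shortest one
  -- a could have come from, and the exchange lemmas move the reading there.
  module _ (lam : Fin s → ℕ) (p : Fin s) where
    open BlockOrder lam
    open LowerColumn lam p

    TailFits : ℕ → List ℕ → Set
    TailFits n c = Σ ℕ (λ m' → Fits s (rowLength lam⁻) m' c × ∑ s lam⁻ + m' ≡ n)

    tail-empty : ∀ {n m c} → lam p ≡ 0 → ∑ s lam + m ≡ suc n → Fits s (rowLength lam) m (rank p ∷ c) → TailFits n c
    tail-empty lp≡0 e (stair j rank<row _) = ⊥-elim (NP.<-irrefl refl (NP.<-≤-trans rank<row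
      (NP.≤-trans (conj-antitone (s≤s z≤n)) (emptyColumn-rank p lp≡0))))
    tail-empty {m = suc m'} lp≡0 e (const _ d) = m' ,
      fits-ext d (rowLength lam⁻) (rowLength-empty lp≡0) ,
      NP.suc-injective (trans (cong suc (cong (_+ m') (size-empty lp≡0))) (trans (sym (NP.+-suc _ m')) e))

    tail-nonempty : ∀ {n m c} l → lam p ≡ suc l → ∑ s lam + m ≡ suc n → Fits s (rowLength lam) m (rank p ∷ c) → TailFits n c
    tail-nonempty {m = m} {c} l lp≡1+l e d = m ,
      fits-ext (readFrom-row d) (rowLength lam⁻) (Nonempty.rowLength-nonempty l lp≡1+l) ,
      NP.suc-injective (trans (cong (_+ m) (sym (Nonempty.size-nonempty l lp≡1+l))) e)
      where
      rank<row : rank p < rowLength lam l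
      rank<row = subst (rank p <_) (cong (conj lam) lp≡1+l) (rank<conj p)
      readFrom-row : ∀ {m} → Fits s (rowLength lam) m (rank p ∷ c) → Fits s (lower (rowLength lam) l) m c
      readFrom-row (const _ d') = fits-toConst d' l (NP.≤-<-trans z≤n rank<row) (conj≤s (suc l))
      readFrom-row (stair j rank<rowj d') = fits-lowerShorter j l (NP.≤-<-trans z≤n rank<row) (conj-antitone (s≤s j≤l)) d'
        where
        -- rows below row λ_p are shorter than rank p
        j≤l : j ≤ l
        j≤l = NP.≮⇒≥ (λ l<j → NP.<-irrefl refl (NP.<-≤-trans rank<rowj
                (NP.≤-trans (conj-antitone (s≤s l<j)) (subst (λ v → conj lam (suc v) ≤ rank p) lp≡1+l (conj-suc≤rank p)))))

    fits-tail : ∀ {n m c} → ∑ s lam + m ≡ suc n → Fits s (rowLength lam) m (rank p ∷ c) → TailFits n c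
    fits-tail {n} {c = c} e d = byLength (lam p) refl
      where
      byLength : ∀ v → lam p ≡ v → TailFits n c
      byLength zero    lp≡0   = tail-empty lp≡0 e d
      byLength (suc l) lp≡1+l = tail-nonempty l lp≡1+l e d

  -- Surjectivity: the first entry a of a fitting code is the rank of a unique
  -- block p; put the smallest element there and recurse on the tail.
  code-surjective : ∀ n (lam : Fin s → ℕ) m c → 1 ≤ s → ∑ s lam + m ≡ n → Fits s (rowLength lam) m c →
                    Σ (Fin n → Fin s) (λ f → InOP n s lam f × code lam f ≡ c)
  code-surjective zero lam m [] _ e _ = (λ ()) , (λ q → NP.≤-reflexive (sizeZero-empty lam m e q)) , refl
  code-surjective zero lam m (a ∷ c) _ e (stair j a<row _) =
    ⊥-elim (NP.n≮0 (subst (a <_) (emptyPartition-rowLength lam (sizeZero-empty lam m e) j) a<row))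
  code-surjective zero lam (suc m) (a ∷ c) _ e (const _ _) = ⊥-elim (NP.1+n≢0 (trans (sym (NP.+-suc _ m)) e))
  code-surjective (suc n) lam .0 [] _ e (done z) =
    ⊥-elim (NP.1+n≢0 (trans (sym e) (trans (NP.+-identityʳ _) (∑-zero s (firstRow-empty lam (z 0))))))
  code-surjective (suc n) lam m (a ∷ c) 1≤s e d =
    f , opf , trans (Removal.code-suc lam f) (cong₂ _∷_ (trans (Head.codeAt-zero lam f opf) rank≡a) (proj₂ (proj₂ rest)))
    where
    first = BlockOrder.rank-surjective lam a (firstEntry<s 1≤s d)
    p : Fin s
    p = proj₁ first
    rank≡a : BlockOrder.rank lam p ≡ a
    rank≡a = proj₂ first
    tail = fits-tail lam p e (subst (λ x → Fits s (rowLength lam) m (x ∷ c)) (sym rank≡a) d)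
    rest = code-surjective n (lowerPart lam p) (proj₁ tail) c 1≤s (proj₂ (proj₂ tail)) (proj₁ (proj₂ tail))
    f : Fin (suc n) → Fin s
    f = p Vector.∷ proj₁ rest
    opf : InOP (suc n) s lam f
    opf = Removal.inOP-insert lam f (proj₁ (proj₂ rest))

-- The code set as staircase readings: for |λ| = k ≤ n the family codeSeqs is
-- the staircase family of the row lengths of λ (all rows below k are empty)
-- with n - k constant entries, so InC is Fits with m = n - k.
module CodeSet (n k s : ℕ) (lam : Fin s → ℕ) (size≡k : ∑ s lam ≡ k) where
  open Staircases s

  rowLength-vanishing : Vanishing k (rowLength lam)
  rowLength-vanishing j k≤j = trans (BlockOrder.conj≡∑ lam (suc j)) (∑-zero s (λ q → χ-no
    (λ 1+j≤lq → NP.<-irrefl refl (NP.≤-trans 1+j≤lq (NP.≤-trans (∑-term≤ s lam q) (NP.≤-trans (NP.≤-reflexive size≡k) k≤j))))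
    (suc j ℕ.≤? lam q)))

  codeSeqs≡stairs : codeSeqs n k s lam ≡ Stairs (rowLength lam) 0 k (n ∸ k)
  codeSeqs≡stairs = cong (λ js → map (downFrom ∘ rowLength lam) js ++ (replicate (n ∸ k) (s ∸ 1) ∷ [])) (upTo≡range k)

  fits⇒inC : ∀ {c} → Fits s (rowLength lam) (n ∸ k) c → InC n k s lam c
  fits⇒inC d with fits⇒shuffle k d rowLength-vanishing
  ... | w , sh , c≤w = w , subst (λ ws → Shuffle ws w) (sym codeSeqs≡stairs) sh , c≤w

  inC⇒fits : ∀ {c} → InC n k s lam c → Fits s (rowLength lam) (n ∸ k) c
  inC⇒fits {c} (w , sh , c≤w) = shuffle⇒fits k c w (subst (λ ws → Shuffle ws w) codeSeqs≡stairs sh) c≤w rowLength-vanishing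

theorem3p6 : (n k s : ℕ) (lam : Fin s → ℕ) → 1 ≤ k → k ≤ n → IsPartition k s lam →
  ((f : Fin n → Fin s) → InOP n s lam f → InC n k s lam (code lam f))
  × ((f g : Fin n → Fin s) → InOP n s lam f → InOP n s lam g →
       code lam f ≡ code lam g → (x : Fin n) → f x ≡ g x)
  × ((c : List ℕ) → InC n k s lam c →
       Σ (Fin n → Fin s) (λ f → InOP n s lam f × code lam f ≡ c))
theorem3p6 n k s lam 1≤k k≤n (_ , sum≡k) =
  (λ f op → fits⇒inC (code-fits n lam (n ∸ k) f op size+rest≡n)) ,
  code-injective n lam ,
  (λ c c∈C → code-surjective n lam (n ∸ k) c 1≤s size+rest≡n (inC⇒fits c∈C))
  where
  size≡k : ∑ s lam ≡ k
  size≡k = trans (sym (sum-allFin s lam)) sum≡k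
  open CodeSet n k s lam size≡k
  size+rest≡n : ∑ s lam + (n ∸ k) ≡ n
  size+rest≡n = trans (cong (_+ (n ∸ k)) size≡k) (NP.m+[n∸m]≡n k≤n)
  1≤s : 1 ≤ s
  1≤s = ∑-pos⇒nonempty s lam (subst (1 ≤_) (sym size≡k) 1≤k)
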